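{- Let $\lambda$ be a partition and $\pi$ a reverse plane partition of shape $\lambda$ whose candidate set $\mathcal{C}(\pi)$ is nonempty, and let $u$ be the minimum of $\mathcal{C}(\pi)$ with respect to the content order $\trianglelefteq$. Then $\pi-Q(\pi,u)$ is a reverse plane partition of shape $\lambda$, and if $h_2,\dots,h_s$ is a lexicographic factorisation of $\pi-Q(\pi,u)$, then $h(\pi,u),h_2,\dots,h_s$ is a lexicographic factorisation of $\pi$.
   Context: Cells are pairs $u=(u_1,u_2)\in\mathbb{Z}^2$ (row, column). Neighbours: $\mathrm{n}u=(u_1-1,u_2)$, $\mathrm{e}u=(u_1,u_2+1)$, $\mathrm{s}u=(u_1+1,u_2)$, $\mathrm{w}u=(u_1,u_2-1)$. The content of $u$ is $c(u)=u_2-u_1$. A partition $\lambda_1\ge\dots\ge\lambda_r>0$ is identified with its Young diagram $\lambda=\{(i,j):1\le i\le r,\ 1\le j\le\lambda_i\}$; $\lambda'$ is the conjugate partition. A reverse plane partition of shape $\lambda$ is a map $\pi:\lambda\to\mathbb{N}=\{0,1,2,\dots\}$ with $\pi(u)\le\pi(\mathrm{e}u)$ and $\pi(u)\le\pi(\mathrm{s}u)$ whenever these cells lie in $\lambda$; by convention $\pi(u)=0$ if $u_1\le0$ or $u_2\le0$, and $\pi(u)=\infty$ if $u_1,u_2\ge1$ but $u\notin\lambda$. The content order on $\lambda$: $u\trianglelefteq v$ iff $c(u)>c(v)$, or $c(u)=c(v)$ and $u_1\ge v_1$. A North-East-path in $\lambda$ is a sequence $P=(u_0,\dots,u_s)$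 of cells of $\lambda$ with $u_k\in\{\mathrm{n}u_{k-1},\mathrm{e}u_{k-1}\}$ for $k=1,\dots,s$; its length is $\ell(P)=s$, head $\alpha(P)=u_0$, tail $\omega(P)=u_s$. A rim-hook of $\lambda$ is a North-East-path $h$ in $\lambda$ with $\mathrm{s}\alpha(h)\notin\lambda$, $\mathrm{e}\omega(h)\notin\lambda$, and $\mathrm{e}\mathrm{s}u\notin\lambda$ for all $u\in h$. For each cell $(i,j)\in\lambda$ there is a unique rim-hook with $\alpha(h)=(\lambda'_j,j)$ and $\omega(h)=(i,\lambda_i)$. Rim-hooks are ordered by: $f\le h$ iff $c(\alpha(f))>c(\alpha(h))$, or $c(\alpha(f))=c(\alpha(h))$ and $c(\omega(f))\le c(\omega(h))$. A cell $u\in\lambda$ is an outer corner if $\mathrm{e}u,\mathrm{s}u\notin\lambda$, and an inner corner if $\mathrm{e}u,\mathrm{s}u\in\lambda$ but $\mathrm{e}\mathrm{s}u\notin\lambda$. Let $i_1,\dots,i_r$ be the contents of the inner corners and $o_1,\dots,o_{r+1}$ those of the outer corners, ordered so that $o_1<i_1<o_2<\dots<o_r<i_r<o_{r+1}$. Define $\mathcal{I}=\{u\in\lambda:c(u)=i_k\text{ for some }k\}$, $\mathcal{O}=\{u\in\lambda:c(u)=o_k\text{ for some }k\}$, $\mathcal{A}=\{u\in\lambda:c(u)<o_1\text{ or }i_k<c(u)<o_{k+1}\text{ for some }k\in[r]\}$, $\mathcal{B}=\{u\in\lambda:o_k<c(u)<i_k\text{ for some }k\in[r]\text{ or }c(u)>o_{r+1}\}$.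 For a path $P$ in $\lambda$, $\pi\pm P:\lambda\to\mathbb{Z}$ is given by $(\pi\pm P)(u)=\pi(u)\pm1$ if $u\in P$ and $\pi(u)$ otherwise. $P$ is $\pi$-compatible if (1) whenever $u\in P$ and $u\in\mathcal{I}\cup\mathcal{A}$, then $\mathrm{e}u\in P$ and $\pi(\mathrm{e}u)=\pi(u)$; and (2) whenever $u,\mathrm{n}u\in P$, then $\pi(\mathrm{n}u)=\pi(u)$. A rim-hook $h$ inserts into $\pi$ if there is a $\pi$-compatible North-East-path $P$ with $\omega(P)=\omega(h)$, $\ell(P)=\ell(h)$ and $\pi+P$ a reverse plane partition; such $P$ is unique and $h*\pi:=\pi+P$. A lexicographic factorisation of $\pi$ is a sequence of rim-hooks $h_1\le h_2\le\dots\le h_s$ with $h_1*(h_2*(\dots*(h_s*0)))=\pi$ ($0$ the zero reverse plane partition). Candidates: $\mathcal{C}(\pi)=\{u\in\mathcal{O}:\pi(u)>\pi(\mathrm{w}u)\}\cup\{u\in\mathcal{A}:\pi(u)>\pi(\mathrm{w}u)\text{ and }\pi(u)>\pi(\mathrm{n}u)\}$. For $u\in\mathcal{C}(\pi)$, the North-East-path $Q(\pi,u)$ starts at $u$; if $v$ is the current cell, move to $\mathrm{n}v$ if $v\in\mathcal{O}\cup\mathcal{B}$ and $\pi(\mathrm{n}v)=\pi(v)$; move to $\mathrm{e}v$ if $v\in\mathcal{I}\cup\mathcal{A}$, or if $\pi(\mathrm{n}v)<\pi(v)$ and $\mathrm{e}v\in\lambda$; terminate if $\pi(\mathrm{n}v)<\pi(v)$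 but $\mathrm{e}v\notin\lambda$. The rim-hook $h(\pi,u)$ is the rim-hook of $\lambda$ with $\omega(h(\pi,u))=\omega(Q(\pi,u))$ and $\ell(h(\pi,u))=\ell(Q(\pi,u))$. -}

module Defs where

open import Data.Bool using (Bool; true; false; if_then_else_; _∨_)
open import Data.Nat as ℕ using (ℕ; suc)
open import Data.Integer as ℤ using (ℤ; +_; 0ℤ; 1ℤ; _-_; _<_; _≤_; _>_; _≤ᵇ_)
import Data.Integer.Properties as ℤP
open import Data.Fin using (Fin; toℕ)
open import Data.List using (List; []; _∷_; length; lookup; zip; foldl)
open import Data.List.Relation.Unary.All using (All)
open import Data.List.Relation.Unary.Any using (Any)
open import Data.List.Relation.Unary.Linked using (Linked)
open import Data.List.Membership.Propositional using (_∈_)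
open import Data.List.Membership.DecPropositional as DecMem using ()
open import Data.Product using (Σ; _×_; _,_; proj₁; proj₂)
open import Data.Product.Properties using (≡-dec)
open import Data.Sum using (_⊎_)
open import Data.Unit using (⊤)
open import Data.Empty using (⊥)
open import Relation.Nullary using (¬_; Dec; does)
open import Relation.Binary.PropositionalEquality using (_≡_)

Cell : Set
Cell = ℤ × ℤ

row col : Cell → ℤ
row = proj₁
col = proj₂

nC eC sC wC : Cell → Cell
nC (i , j) = (i - 1ℤ , j)
eC (i , j) = (i , j ℤ.+ 1ℤ)
sC (i , j) = (i ℤ.+ 1ℤ , j)
wC (i , j) = (i , j - 1ℤ)

content : Cell → ℤ
content (i , j) = j - i

_≟C_ : (u v : Cell) → Dec (u ≡ v)
_≟C_ = ≡-dec ℤP._≟_ ℤP._≟_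

IsPartition : List ℕ → Set
IsPartition sh = Linked ℕ._≥_ sh × All (ℕ._<_ 0) sh

_∈Y_ : Cell → List ℕ → Set
(i , j) ∈Y sh = Σ (Fin (length sh)) λ k →
  (i ≡ + suc (toℕ k)) × (1ℤ ≤ j) × (j ≤ + lookup sh k)

-- Maps on cells; reverse plane partitions (values outside λ are irrelevant)

IsRPP : List ℕ → (Cell → ℤ) → Set
IsRPP sh π = ∀ u → u ∈Y sh →
  (0ℤ ≤ π u) × (eC u ∈Y sh → π u ≤ π (eC u)) × (sC u ∈Y sh → π u ≤ π (sC u))

-- the convention π(u) = 0 if u₁ ≤ 0 or u₂ ≤ 0 (only ever applied to
-- nu, wu for u ∈ λ, which are in λ or have a non-positive coordinate)
ext : (Cell → ℤ) → Cell → ℤ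
ext π (i , j) = if (i ≤ᵇ 0ℤ) ∨ (j ≤ᵇ 0ℤ) then 0ℤ else π (i , j)

_⊴_ : Cell → Cell → Set
u ⊴ v = (content u > content v) ⊎ ((content u ≡ content v) × (row u ℤ.≥ row v))

OuterCorner InnerCorner : List ℕ → Cell → Set
OuterCorner sh u = u ∈Y sh × ¬ (eC u ∈Y sh) × ¬ (sC u ∈Y sh)
InnerCorner sh u = u ∈Y sh × eC u ∈Y sh × sC u ∈Y sh × ¬ (eC (sC u) ∈Y sh)

Interleave : ℤ → List ℤ → List ℤ → Set
Interleave o [] [] = ⊤
Interleave o (o' ∷ os) (i ∷ is) = (o < i) × (i < o') × Interleave o' os is
Interleave o [] (_ ∷ _) = ⊥
Interleave o (_ ∷ _) [] = ⊥

-- the contents of the outer corners (o₁ ∷ os) and inner corners (is),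
-- listed in the order o₁ < i₁ < o₂ < … < iᵣ < o_{r+1}
record Corners (sh : List ℕ) : Set where
  field
    o₁ : ℤ
    os : List ℤ
    is : List ℤ
    interleave : Interleave o₁ os is
    outer→ : ∀ w → OuterCorner sh w → content w ∈ (o₁ ∷ os)
    →outer : ∀ k → k ∈ (o₁ ∷ os) → Σ Cell λ w → OuterCorner sh w × content w ≡ k
    inner→ : ∀ w → InnerCorner sh w → content w ∈ is
    →inner : ∀ k → k ∈ is → Σ Cell λ w → InnerCorner sh w × content w ≡ k

  oLast : ℤ
  oLast = foldl (λ _ x → x) o₁ os

open Corners public

module _ {sh : List ℕ} (K : Corners sh) where

  Between : ℤ → ℤ × ℤ → Set
  Between c (a , b) = (a < c) × (c < b)

  inI inO inA inB : Cell → Set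
  inI u = u ∈Y sh × content u ∈ is K
  inO u = u ∈Y sh × content u ∈ (o₁ K ∷ os K)
  inA u = u ∈Y sh × ((content u < o₁ K) ⊎ Any (Between (content u)) (zip (is K) (os K)))
  inB u = u ∈Y sh × (Any (Between (content u)) (zip (o₁ K ∷ os K) (is K)) ⊎ (oLast K < content u))

  Cand : (Cell → ℤ) → Cell → Set
  Cand π u = (inO u × ext π (wC u) < π u)
           ⊎ (inA u × ext π (wC u) < π u × ext π (nC u) < π u)

data Dir : Set where
  N E : Dir

move : Dir → Cell → Cell
move N = nC
move E = eC

NEPath : Set
NEPath = Cell × List Dir

cellsFrom : Cell → List Dir → List Cell
cellsFrom u [] = u ∷ []
cellsFrom u (d ∷ ds) = u ∷ cellsFrom (move d u) ds

cells : NEPath → List Cell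
cells (u , ds) = cellsFrom u ds

headP : NEPath → Cell
headP = proj₁

tailFrom : Cell → List Dir → Cell
tailFrom u [] = u
tailFrom u (d ∷ ds) = tailFrom (move d u) ds

tailP : NEPath → Cell
tailP (u , ds) = tailFrom u ds

lenP : NEPath → ℕ
lenP (_ , ds) = length ds

_∈P_ : Cell → NEPath → Set
u ∈P P = u ∈ cells P

InY : List ℕ → NEPath → Set
InY sh P = All (_∈Y sh) (cells P)

indicator : NEPath → Cell → ℤ
indicator P u = if does (DecMem._∈?_ _≟C_ u (cells P)) then 1ℤ else 0ℤ

_⊕_ _⊖_ : (Cell → ℤ) → NEPath → (Cell → ℤ)
(π ⊕ P) u = π u ℤ.+ indicator P u
(π ⊖ P) u = π u - indicator P u

IsRimHook : List ℕ → NEPath → Set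
IsRimHook sh h = InY sh h × ¬ (sC (headP h) ∈Y sh) × ¬ (eC (tailP h) ∈Y sh)
               × (∀ u → u ∈P h → ¬ (eC (sC u) ∈Y sh))

_≤h_ : NEPath → NEPath → Set
f ≤h h = (content (headP f) > content (headP h))
       ⊎ ((content (headP f) ≡ content (headP h)) × (content (tailP f) ≤ content (tailP h)))

-- The path Q(π,u), as the relation "ds are the moves of the path
-- produced by the rules, started at v"

module _ {sh : List ℕ} (K : Corners sh) (π : Cell → ℤ) where

  data QFrom : Cell → List Dir → Set where
    goN : ∀ {v ds} → (inO K v ⊎ inB K v) → ext π (nC v) ≡ π v →
          QFrom (nC v) ds → QFrom v (N ∷ ds)
    goE₁ : ∀ {v ds} → (inI K v ⊎ inA K v) →
           QFrom (eC v) ds → QFrom v (E ∷ ds)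
    goE₂ : ∀ {v ds} → ext π (nC v) < π v → eC v ∈Y sh →
           QFrom (eC v) ds → QFrom v (E ∷ ds)
    stop : ∀ {v} → ext π (nC v) < π v → ¬ (eC v ∈Y sh) → QFrom v []

module _ {sh : List ℕ} (K : Corners sh) where

  Compatible : (Cell → ℤ) → NEPath → Set
  Compatible π P =
      (∀ u → u ∈P P → (inI K u ⊎ inA K u) → (eC u ∈P P) × (π (eC u) ≡ π u))
    × (∀ u → u ∈P P → nC u ∈P P → π (nC u) ≡ π u)

  -- Inserts h σ ρ : h inserts into σ and h * σ = ρ (on the cells of λ)
  Inserts : NEPath → (Cell → ℤ) → (Cell → ℤ) → Set
  Inserts h σ ρ = Σ NEPath λ P →
      InY sh P × Compatible σ P × (tailP P ≡ tailP h) × (lenP P ≡ lenP h)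
    × IsRPP sh (σ ⊕ P) × (∀ u → u ∈Y sh → ρ u ≡ (σ ⊕ P) u)

  -- Eval [h₁ … hₛ] ρ : h₁ * (h₂ * ( … (hₛ * 0))) = ρ
  data Eval : List NEPath → (Cell → ℤ) → Set where
    nil  : ∀ {ρ} → (∀ u → u ∈Y sh → ρ u ≡ 0ℤ) → Eval [] ρ
    cons : ∀ {h hs σ ρ} → Eval hs σ → Inserts h σ ρ → Eval (h ∷ hs) ρ

  LexFact : (Cell → ℤ) → List NEPath → Set
  LexFact ρ hs = All (IsRimHook sh) hs × Linked _≤h_ hs × Eval hs ρ

-- The path Q = Q(π,u) climbs from the content-minimal candidate u along
-- plateaus of π. Minimality of u enters through one observation: above a
-- cell z of content class 𝓞 ∪ 𝓐 with π(wz) < π(z) there is a candidate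
-- (climb the column of z while π stays constant), so z does not precede u
-- in the content order. Hence every cell of Q sees a strict drop of π to
-- its north and to its west unless that neighbour lies on Q itself, and
-- π − Q is again a reverse plane partition, into which h(π,u) inserts
-- along Q. The rim of λ can be walked back from the tail of Q, which gives
-- h(π,u); its head has content c(u) ∈ 𝓞 ∪ 𝓐, which on the rim means that
-- nothing of λ lies below it. Finally, if the next hook h₂ inserts into
-- π − Q along a path P₂, the head of P₂ is again such a cell z, so it does
-- not precede u: either its content is smaller than c(u), or it lies on
-- the diagonal of u, where P₂ stays weakly north-west of Q and therefore
-- is at least as long. Either way h(π,u) ≤ h₂.

module Submission where

open import Defs
open import Data.Bool using (true; false; if_then_else_)
open import Data.Empty using (⊥; ⊥-elim)
open import Data.Fin using (Fin; toℕ) renaming (zero to fzero; suc to fsuc)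
open import Data.Fin.Properties using (toℕ<n)
open import Data.Integer as ℤ
  using (ℤ; +_; -[1+_]; 0ℤ; 1ℤ; _-_; _+_; _<_; _≤_; _≤ᵇ_; +≤+; -≤+)
open import Data.Integer.Properties
open import Data.Integer.Tactic.RingSolver using (solve-∀)
open import Data.List using (List; []; _∷_; _++_; length; lookup; zip; foldl)
open import Data.List.Properties using (length-++)
open import Data.List.Membership.Propositional using (_∈_)
open import Data.List.Membership.DecPropositional _≟C_ using (_∈?_)
open import Data.List.Relation.Unary.All as All using (All; []; _∷_)
open import Data.List.Relation.Unary.All.Properties using (++⁺)
open import Data.List.Relation.Unary.Any using (Any; here; there)
import Data.List.Relation.Unary.Linked as Linked
open import Data.Nat as ℕ using (ℕ)
import Data.Nat.Properties as ℕP
open import Data.Product using (Σ; _×_; _,_; proj₁; proj₂) renaming (map to Σ-map)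
open import Data.Sum using (_⊎_; inj₁; inj₂; swap)
open import Relation.Binary.Definitions using (tri<; tri≈; tri>)
open import Relation.Binary.PropositionalEquality
  using (_≡_; _≢_; refl; sym; trans; cong; cong₂; subst; subst₂; module ≡-Reasoning)
open import Relation.Nullary using (¬_; Dec; yes; no)

<⇒+1≤ : ∀ {i j} → i < j → i + 1ℤ ≤ j
<⇒+1≤ {i} {j} i<j = subst (_≤ j) (+-comm 1ℤ i) (i<j⇒suc[i]≤j i<j)

+1≤⇒< : ∀ {i j} → i + 1ℤ ≤ j → i < j
+1≤⇒< {i} {j} i+1≤j = suc[i]≤j⇒i<j (subst (_≤ j) (+-comm i 1ℤ) i+1≤j)

i<i+1 : ∀ i → i < i + 1ℤ
i<i+1 i = +1≤⇒< ≤-refl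

i-1<i : ∀ i → i - 1ℤ < i
i-1<i i = +1≤⇒< (≤-reflexive (lemma i))
  where
  lemma : ∀ i → i - 1ℤ + 1ℤ ≡ i
  lemma = solve-∀

<⇒≤-1 : ∀ {i j} → i < j → i ≤ j - 1ℤ
<⇒≤-1 {i} {j} i<j = subst (_≤ j - 1ℤ) (lemma i) (+-monoˡ-≤ (ℤ.- 1ℤ) (<⇒+1≤ i<j))
  where
  lemma : ∀ i → i + 1ℤ - 1ℤ ≡ i
  lemma = solve-∀

<+1⇒≤ : ∀ {i j} → i < j + 1ℤ → i ≤ j
<+1⇒≤ {i} {j} i<j+1 = subst (i ≤_) (lemma j) (<⇒≤-1 i<j+1)
  where
  lemma : ∀ j → j + 1ℤ - 1ℤ ≡ j
  lemma = solve-∀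

≤⇒<+1 : ∀ {i j} → i ≤ j → i < j + 1ℤ
≤⇒<+1 {j = j} i≤j = ≤-<-trans i≤j (i<i+1 j)

-1-cancel-≤ : ∀ {i j} → i - 1ℤ ≤ j - 1ℤ → i ≤ j
-1-cancel-≤ {i} {j} p = subst₂ _≤_ (lemma i) (lemma j) (+-monoˡ-≤ 1ℤ p)
  where
  lemma : ∀ i → i - 1ℤ + 1ℤ ≡ i
  lemma = solve-∀

≤⇒<⊎≡ : ∀ {i j} → i ≤ j → (i < j) ⊎ (i ≡ j)
≤⇒<⊎≡ {i} {j} i≤j with <-cmp i j
... | tri< i<j _ _ = inj₁ i<j
... | tri≈ _ i≡j _ = inj₂ i≡j
... | tri> _ _ j<i = ⊥-elim (<-irrefl refl (<-≤-trans j<i i≤j))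

1≰0 : ∀ {i} → 1ℤ ≤ i → ¬ (i ≤ 0ℤ)
1≰0 1≤i i≤0 with ≤-trans 1≤i i≤0
... | +≤+ ()

1≤⇒≡+suc : ∀ {i} → 1ℤ ≤ i → Σ ℕ λ n → i ≡ + ℕ.suc n
1≤⇒≡+suc {+ ℕ.suc n} _ = n , refl
1≤⇒≡+suc {+ ℕ.zero} (+≤+ ())

fuel-pred : ∀ {i n} → i ≤ + ℕ.suc n → i - 1ℤ ≤ + n
fuel-pred {i} {n} i≤1+n = subst (i - 1ℤ ≤_) (lemma n) (+-monoˡ-≤ (ℤ.- 1ℤ) i≤1+n)
  where
  lemma : ∀ n → + ℕ.suc n - 1ℤ ≡ + n
  lemma ℕ.zero = refl
  lemma (ℕ.suc n) = refl

fuel-pred-sub : ∀ {m i j n} → j ≡ i + 1ℤ → m - i ≤ + ℕ.suc n → m - j ≤ + n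
fuel-pred-sub {m} {i} refl m-i≤1+n = subst (_≤ _) (lemma m i) (fuel-pred m-i≤1+n)
  where
  lemma : ∀ m i → m - i - 1ℤ ≡ m - (i + 1ℤ)
  lemma = solve-∀

fuel-exhausted : ∀ {m i j} → m - i ≤ 0ℤ → i < j → ¬ (j ≤ m)
fuel-exhausted m-i≤0 i<j j≤m = <-irrefl refl (<-≤-trans i<j (≤-trans j≤m (i-j≤0⇒i≤j m-i≤0)))

sub-suc : ∀ {c c'} k → c' + 1ℤ ≡ c → c - + ℕ.suc k ≡ c' - + k
sub-suc {c' = c'} k refl = trans (cong (λ l → c' + 1ℤ - l) (pos-+ 1 k)) (lemma c' (+ k))
  where
  lemma : ∀ c' k → c' + 1ℤ - (1ℤ + k) ≡ c' - k
  lemma = solve-∀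

i-suc<i : ∀ i k → i - + ℕ.suc k < i
i-suc<i i k = subst (i - + ℕ.suc k <_) (+-identityʳ i) (+-monoʳ-< i ℤ.-<+)

0<1 : 0ℤ < 1ℤ
0<1 = ℤ.+<+ (ℕ.s≤s ℕ.z≤n)

sub₂-≤⇒< : ∀ {x y i j k l} → x - i - k ≤ y - j - l → i ≤ j → k < l → x < y
sub₂-≤⇒< {x} {y} {i} {j} {k} {l} le i≤j k<l = ≤-<-trans x≤ (subst (_< y) (lemma y j l i k) below)
  where
  restore : ∀ x i k → x - i - k + (i + k) ≡ x
  restore = solve-∀
  lemma : ∀ y j l i k → y - (j + l) + (i + k) ≡ y - j - l + (i + k)
  lemma = solve-∀
  x≤ : x ≤ y - j - l + (i + k)
  x≤ = subst (_≤ y - j - l + (i + k)) (restore x i k) (+-monoˡ-≤ (i + k) le)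
  below : y - (j + l) + (i + k) < y
  below = subst (y - (j + l) + (i + k) <_) (restore' y j l)
            (+-monoʳ-< (y - (j + l)) (+-mono-≤-< i≤j k<l))
    where
    restore' : ∀ y j l → y - (j + l) + (j + l) ≡ y
    restore' = solve-∀

≤+∣∣ : ∀ {i} → 0ℤ ≤ i → i ≤ + ℤ.∣ i ∣
≤+∣∣ 0≤i = ≤-reflexive (sym (0≤i⇒+∣i∣≡i 0≤i))

-- Cells and North-East paths

content-nC : ∀ u → content (nC u) ≡ content u + 1ℤ
content-nC (i , j) = lemma i j
  where
  lemma : ∀ i j → j - (i - 1ℤ) ≡ (j - i) + 1ℤ
  lemma = solve-∀

content-eC : ∀ u → content (eC u) ≡ content u + 1ℤ
content-eC (i , j) = lemma i j
  where
  lemma : ∀ i j → (j + 1ℤ) - i ≡ (j - i) + 1ℤ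
  lemma = solve-∀

content-sC+1 : ∀ u → content (sC u) + 1ℤ ≡ content u
content-sC+1 (i , j) = lemma i j
  where
  lemma : ∀ i j → j - (i + 1ℤ) + 1ℤ ≡ j - i
  lemma = solve-∀

content-wC+1 : ∀ u → content (wC u) + 1ℤ ≡ content u
content-wC+1 (i , j) = lemma i j
  where
  lemma : ∀ i j → (j - 1ℤ) - i + 1ℤ ≡ j - i
  lemma = solve-∀

content-eC-sC : ∀ u → content (eC (sC u)) ≡ content u
content-eC-sC (i , j) = lemma i j
  where
  lemma : ∀ i j → (j + 1ℤ) - (i + 1ℤ) ≡ j - i
  lemma = solve-∀

content-move : ∀ d u → content (move d u) ≡ content u + 1ℤ
content-move N = content-nC
content-move E = content-eC

content<content-move : ∀ d u → content u < content (move d u)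
content<content-move d u = subst (content u <_) (sym (content-move d u)) (i<i+1 _)

sC-nC : ∀ u → sC (nC u) ≡ u
sC-nC (i , j) = cong (_, j) (lemma i)
  where
  lemma : ∀ i → i - 1ℤ + 1ℤ ≡ i
  lemma = solve-∀

nC-sC : ∀ u → nC (sC u) ≡ u
nC-sC (i , j) = cong (_, j) (lemma i)
  where
  lemma : ∀ i → i + 1ℤ - 1ℤ ≡ i
  lemma = solve-∀

wC-eC : ∀ u → wC (eC u) ≡ u
wC-eC (i , j) = cong (i ,_) (lemma j)
  where
  lemma : ∀ j → j + 1ℤ - 1ℤ ≡ j
  lemma = solve-∀

eC-wC : ∀ u → eC (wC u) ≡ u
eC-wC (i , j) = cong (i ,_) (lemma j)
  where
  lemma : ∀ j → j - 1ℤ + 1ℤ ≡ j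
  lemma = solve-∀

eC-sC-wC : ∀ u → eC (sC (wC u)) ≡ sC u
eC-sC-wC (i , j) = cong (i + 1ℤ ,_) (lemma j)
  where
  lemma : ∀ j → j - 1ℤ + 1ℤ ≡ j
  lemma = solve-∀

row-nC< : ∀ u → row (nC u) < row u
row-nC< (i , _) = i-1<i i

row-move≤ : ∀ d u → row (move d u) ≤ row u
row-move≤ N u = <⇒≤ (row-nC< u)
row-move≤ E u = ≤-refl

row-1≤row-move : ∀ d u → row u - 1ℤ ≤ row (move d u)
row-1≤row-move N u = ≤-refl
row-1≤row-move E u = <⇒≤ (i-1<i (row u))

row-content-injective : ∀ {u v} → row u ≡ row v → content u ≡ content v → u ≡ v
row-content-injective {i , j} {.i , j'} refl c≡c' =
  cong (i ,_) (trans (sym (lemma i j)) (trans (cong (_+ i) c≡c') (lemma i j')))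
  where
  lemma : ∀ i j → j - i + i ≡ j
  lemma = solve-∀

u≢nC : ∀ u → u ≢ nC u
u≢nC u u≡nu = <-irrefl (sym (cong row u≡nu)) (row-nC< u)

headFrom∈cellsFrom : ∀ v ds → v ∈ cellsFrom v ds
headFrom∈cellsFrom v [] = here refl
headFrom∈cellsFrom v (_ ∷ _) = here refl

tailFrom∈cellsFrom : ∀ v ds → tailFrom v ds ∈ cellsFrom v ds
tailFrom∈cellsFrom v [] = here refl
tailFrom∈cellsFrom v (d ∷ ds) = there (tailFrom∈cellsFrom (move d v) ds)

content-tailFrom : ∀ v ds → content (tailFrom v ds) ≡ content v + + length ds
content-tailFrom v [] = sym (+-identityʳ _)
content-tailFrom v (d ∷ ds) = begin
  content (tailFrom (move d v) ds)      ≡⟨ content-tailFrom (move d v) ds ⟩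
  content (move d v) + + length ds      ≡⟨ cong (_+ + length ds) (content-move d v) ⟩
  content v + 1ℤ + + length ds          ≡⟨ +-assoc (content v) 1ℤ (+ length ds) ⟩
  content v + (1ℤ + + length ds)        ≡⟨ cong (λ l → content v + l) (sym (pos-+ 1 (length ds))) ⟩
  content v + + length (d ∷ ds)         ∎
  where open ≡-Reasoning

content-headFrom : ∀ v ds → content v ≡ content (tailFrom v ds) - + length ds
content-headFrom v ds = trans (sym (lemma (content v) (+ length ds))) (cong (_- + length ds) (sym (content-tailFrom v ds)))
  where
  lemma : ∀ c l → c + l - l ≡ c
  lemma = solve-∀

tailFrom-snoc : ∀ v ds d → tailFrom v (ds ++ d ∷ []) ≡ move d (tailFrom v ds)
tailFrom-snoc v [] d = refl
tailFrom-snoc v (d' ∷ ds) d = tailFrom-snoc (move d' v) ds d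

cellsFrom-snoc : ∀ v ds d → cellsFrom v (ds ++ d ∷ []) ≡ cellsFrom v ds ++ move d (tailFrom v ds) ∷ []
cellsFrom-snoc v [] d = refl
cellsFrom-snoc v (d' ∷ ds) d = cong (v ∷_) (cellsFrom-snoc (move d' v) ds d)

cellsFrom-bounds : ∀ v ds {x} → x ∈ cellsFrom v ds →
                   (content v ≤ content x) × (row x ≤ row v) × (col v ≤ col x)
cellsFrom-bounds v [] (here refl) = ≤-refl , ≤-refl , ≤-refl
cellsFrom-bounds v (_ ∷ _) (here refl) = ≤-refl , ≤-refl , ≤-refl
cellsFrom-bounds v (d ∷ ds) (there x∈) with cellsFrom-bounds (move d v) ds x∈
... | c≤ , r≤ , k≤ =
  ≤-trans (<⇒≤ (content<content-move d v)) c≤ , ≤-trans r≤ (row-move≤ d v) , ≤-trans (col≤ d) k≤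
  where
  col≤ : ∀ d → col v ≤ col (move d v)
  col≤ N = ≤-refl
  col≤ E = <⇒≤ (i<i+1 (col v))

PathEndingAt : (Cell → Set) → Cell → ℕ → Set
PathEndingAt P x k = Σ NEPath λ h → (tailP h ≡ x) × (lenP h ≡ k) × All P (cells h)

snoc-PathEndingAt : ∀ {P : Cell → Set} {p x k} d → move d p ≡ x → P x →
                    PathEndingAt P p k → PathEndingAt P x (ℕ.suc k)
snoc-PathEndingAt {P} {p} {x} {k} d p→x Px ((h , ds) , refl , refl , all) =
  (h , ds ++ d ∷ []) ,
  trans (tailFrom-snoc h ds d) p→x ,
  trans (length-++ ds) (ℕP.+-comm (length ds) 1) ,
  subst (All P) (sym (cellsFrom-snoc h ds d))
        (++⁺ all (subst P (sym p→x) Px ∷ []))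

data Suffix : NEPath → NEPath → Set where
  here  : ∀ {P} → Suffix P P
  there : ∀ {P v d ds} → Suffix P (move d v , ds) → Suffix P (v , d ∷ ds)

∈⇒Suffix : ∀ {v ds x} → x ∈ cellsFrom v ds → Σ (List Dir) λ dsx → Suffix (x , dsx) (v , ds)
∈⇒Suffix {ds = []} (here refl) = [] , here
∈⇒Suffix {ds = _ ∷ _} (here refl) = _ , here
∈⇒Suffix {v} {d ∷ ds} (there x∈) with ∈⇒Suffix {move d v} {ds} x∈
... | dsx , suffix = dsx , there suffix

Suffix-⊆ : ∀ {P R} → Suffix P R → ∀ {z} → z ∈P P → z ∈P R
Suffix-⊆ here z∈ = z∈
Suffix-⊆ (there suffix) z∈ = there (Suffix-⊆ suffix z∈)

Suffix-tail : ∀ {P R} → Suffix P R → tailP P ≡ tailP R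
Suffix-tail here = refl
Suffix-tail (there suffix) = Suffix-tail suffix

Suffix-complete : ∀ {x dsx R} → Suffix (x , dsx) R →
                  ∀ {z} → z ∈P R → content x ≤ content z → z ∈ cellsFrom x dsx
Suffix-complete here z∈ _ = z∈
Suffix-complete {x} {dsx} (there {v = v} {d} {ds} suffix) (here refl) cx≤cv =
  ⊥-elim (<-irrefl refl (<-≤-trans (<-≤-trans (content<content-move d v) cmove≤cx) cx≤cv))
  where
  cmove≤cx : content (move d v) ≤ content x
  cmove≤cx = proj₁ (cellsFrom-bounds (move d v) ds (Suffix-⊆ suffix (headFrom∈cellsFrom x dsx)))
Suffix-complete (there suffix) (there z∈) cx≤cz = Suffix-complete suffix z∈ cx≤cz

Suffix-next : ∀ {v d ds R} → Suffix (v , d ∷ ds) R → Suffix (move d v , ds) R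
Suffix-next here = there here
Suffix-next (there suffix) = there (Suffix-next suffix)

wC∉cellsFrom : ∀ v ds → ¬ (wC v ∈ cellsFrom v ds)
wC∉cellsFrom v ds wv∈ = <-irrefl refl (<-≤-trans (subst (_< content v) (sym cwv≡) (i-1<i _))
                                                 (proj₁ (cellsFrom-bounds v ds wv∈)))
  where
  cwv≡ : content (wC v) ≡ content v - 1ℤ
  cwv≡ = trans (sym (lemma (content (wC v)))) (cong (_- 1ℤ) (content-wC+1 v))
    where
    lemma : ∀ c → c + 1ℤ - 1ℤ ≡ c
    lemma = solve-∀

nC∉cellsFrom-eC : ∀ v ds → ¬ (nC v ∈ cellsFrom (eC v) ds)
nC∉cellsFrom-eC v ds nv∈ = <-irrefl refl (<-≤-trans (i<i+1 (col v)) (proj₂ (proj₂ (cellsFrom-bounds (eC v) ds nv∈))))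

nC∈cellsFrom⇒N : ∀ x es → nC x ∈ cellsFrom x es → Σ (List Dir) λ es' → es ≡ N ∷ es'
nC∈cellsFrom⇒N x [] (here nx≡x) = ⊥-elim (u≢nC x (sym nx≡x))
nC∈cellsFrom⇒N x (N ∷ es) _ = es , refl
nC∈cellsFrom⇒N x (E ∷ es) (here nx≡x) = ⊥-elim (u≢nC x (sym nx≡x))
nC∈cellsFrom⇒N x (E ∷ es) (there nx∈) = ⊥-elim (nC∉cellsFrom-eC x es nx∈)

indicator-∈ : ∀ P {x} → x ∈P P → indicator P x ≡ 1ℤ
indicator-∈ P {x} x∈ with x ∈? cells P
... | yes _ = refl
... | no x∉ = ⊥-elim (x∉ x∈)

indicator-∉ : ∀ P {x} → ¬ (x ∈P P) → indicator P x ≡ 0ℤ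
indicator-∉ P {x} x∉ with x ∈? cells P
... | yes x∈ = ⊥-elim (x∉ x∈)
... | no _ = refl

0≤indicator : ∀ P x → 0ℤ ≤ indicator P x
0≤indicator P x with x ∈? cells P
... | yes _ = +≤+ ℕ.z≤n
... | no _ = ≤-refl

indicator-mono : ∀ P {x y} → (x ∈P P → y ∈P P) → indicator P x ≤ indicator P y
indicator-mono P {x} {y} x→y with x ∈? cells P
... | no _ = 0≤indicator P y
... | yes x∈ = ≤-reflexive (sym (indicator-∈ P (x→y x∈)))

⊴-refl : ∀ {u} → u ⊴ u
⊴-refl = inj₂ (refl , ≤-refl)

⊴-trans : ∀ {u v w} → u ⊴ v → v ⊴ w → u ⊴ w
⊴-trans (inj₁ cv<cu) (inj₁ cw<cv) = inj₁ (<-trans cw<cv cv<cu)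
⊴-trans (inj₁ cv<cu) (inj₂ (cv≡cw , _)) = inj₁ (subst (_< _) cv≡cw cv<cu)
⊴-trans (inj₂ (cu≡cv , _)) (inj₁ cw<cv) = inj₁ (subst (_ <_) (sym cu≡cv) cw<cv)
⊴-trans (inj₂ (cu≡cv , rv≤ru)) (inj₂ (cv≡cw , rw≤rv)) = inj₂ (trans cu≡cv cv≡cw , ≤-trans rw≤rv rv≤ru)

⊴⇒content≥ : ∀ {u v} → u ⊴ v → content v ≤ content u
⊴⇒content≥ (inj₁ cv<cu) = <⇒≤ cv<cu
⊴⇒content≥ (inj₂ (cu≡cv , _)) = ≤-reflexive (sym cu≡cv)

-- Young diagrams

-- part sh n is λ_{n+1}, and 0 beyond the last part.
part : List ℕ → ℕ → ℕ
part [] _ = 0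
part (x ∷ xs) ℕ.zero = x
part (x ∷ xs) (ℕ.suc n) = part xs n

lookup≡part : ∀ (sh : List ℕ) (k : Fin (length sh)) → lookup sh k ≡ part sh (toℕ k)
lookup≡part (x ∷ sh) fzero = refl
lookup≡part (x ∷ sh) (fsuc k) = lookup≡part sh k

part>0⇒index : ∀ (sh : List ℕ) n → 0 ℕ.< part sh n → Σ (Fin (length sh)) λ k → toℕ k ≡ n
part>0⇒index (x ∷ sh) ℕ.zero _ = fzero , refl
part>0⇒index (x ∷ sh) (ℕ.suc n) p with part>0⇒index sh n p
... | k , toℕk≡n = fsuc k , cong ℕ.suc toℕk≡n

part-antitone : ∀ {sh} → Linked.Linked ℕ._≥_ sh → ∀ {m n} → m ℕ.≤ n → part sh n ℕ.≤ part sh m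
part-antitone {[]} _ _ = ℕ.z≤n
part-antitone {x ∷ sh} _ {ℕ.zero} {ℕ.zero} _ = ℕP.≤-refl
part-antitone {x ∷ []} _ {ℕ.zero} {ℕ.suc n} _ = ℕ.z≤n
part-antitone {x ∷ y ∷ sh} (x≥y Linked.∷ L) {ℕ.zero} {ℕ.suc n} _ =
  ℕP.≤-trans (part-antitone L {0} {n} ℕ.z≤n) x≥y
part-antitone {x ∷ []} _ {ℕ.suc m} {ℕ.suc n} _ = ℕ.z≤n
part-antitone {x ∷ y ∷ sh} (_ Linked.∷ L) {ℕ.suc m} {ℕ.suc n} (ℕ.s≤s m≤n) = part-antitone L m≤n

_∈Yℕ_ : Cell → List ℕ → Set
(i , j) ∈Yℕ sh = Σ ℕ λ n → (i ≡ + ℕ.suc n) × (1ℤ ≤ j) × (j ≤ + part sh n)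

∈Y⇒∈Yℕ : ∀ {sh u} → u ∈Y sh → u ∈Yℕ sh
∈Y⇒∈Yℕ {sh} {i , j} (k , i≡ , 1≤j , j≤) =
  toℕ k , i≡ , 1≤j , subst (λ x → j ≤ + x) (lookup≡part sh k) j≤

∈Yℕ⇒∈Y : ∀ {sh u} → u ∈Yℕ sh → u ∈Y sh
∈Yℕ⇒∈Y {sh} {i , j} (n , i≡ , 1≤j , j≤)
  with part>0⇒index sh n (ℕP.<-≤-trans (ℕ.s≤s ℕ.z≤n) (drop‿+≤+ (≤-trans 1≤j j≤)))
... | k , refl = k , i≡ , 1≤j , subst (λ x → j ≤ + x) (sym (lookup≡part sh k)) j≤

module Diagram {sh : List ℕ} (isP : IsPartition sh) where

  ∈Y-downClosed : ∀ {i j i' j'} → (i , j) ∈Y sh →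
                  1ℤ ≤ i' → i' ≤ i → 1ℤ ≤ j' → j' ≤ j → (i' , j') ∈Y sh
  ∈Y-downClosed u∈ 1≤i' i'≤i 1≤j' j'≤j with ∈Y⇒∈Yℕ {sh} u∈ | 1≤⇒≡+suc 1≤i'
  ... | n , refl , _ , j≤ | n' , refl = ∈Yℕ⇒∈Y {sh}
    (n' , refl , 1≤j' , ≤-trans j'≤j (≤-trans j≤ (+≤+ (part-antitone (proj₁ isP) n'≤n))))
    where
    n'≤n : n' ℕ.≤ n
    n'≤n = ℕP.≤-pred (drop‿+≤+ i'≤i)

  ∈Y⇒1≤row : ∀ {u} → u ∈Y sh → 1ℤ ≤ row u
  ∈Y⇒1≤row u∈ with ∈Y⇒∈Yℕ {sh} u∈
  ... | n , refl , _ = +≤+ (ℕ.s≤s ℕ.z≤n)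

  ∈Y⇒1≤col : ∀ {u} → u ∈Y sh → 1ℤ ≤ col u
  ∈Y⇒1≤col (_ , _ , 1≤j , _) = 1≤j

  row≤length : ∀ {u} → u ∈Y sh → row u ≤ + length sh
  row≤length {i , j} (k , refl , _) = +≤+ (toℕ<n k)

  col≤part₀ : ∀ {u} → u ∈Y sh → col u ≤ + part sh 0
  col≤part₀ u∈ with ∈Y⇒∈Yℕ {sh} u∈
  ... | n , _ , _ , j≤ = ≤-trans j≤ (+≤+ (part-antitone (proj₁ isP) ℕ.z≤n))

  content<part₀ : ∀ {u} → u ∈Y sh → content u < + part sh 0
  content<part₀ {i , j} u∈ =
    <-≤-trans (≤-<-trans (+-monoʳ-≤ j (neg-mono-≤ (∈Y⇒1≤row u∈))) (i-1<i j)) (col≤part₀ u∈)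

  _∈Y? : (u : Cell) → Dec (u ∈Y sh)
  (+ ℕ.zero , j) ∈Y? = no λ u∈ → 1≰0 (∈Y⇒1≤row u∈) ≤-refl
  (-[1+ n ] , j) ∈Y? = no λ u∈ → 1≰0 (∈Y⇒1≤row u∈) -≤+
  (+ ℕ.suc n , j) ∈Y? with 1ℤ ≤? j | j ≤? + part sh n
  ... | yes 1≤j | yes j≤ = yes (∈Yℕ⇒∈Y {sh} (n , refl , 1≤j , j≤))
  ... | no 1≰j | _ = no λ u∈ → 1≰j (∈Y⇒1≤col u∈)
  ... | yes _ | no j≰ = no λ u∈ → j≰ (sameRow (∈Y⇒∈Yℕ {sh} u∈))
    where
    sameRow : (+ ℕ.suc n , j) ∈Yℕ sh → j ≤ + part sh n
    sameRow (n' , i≡ , _ , j≤) = subst (λ m → j ≤ + part sh m) (sym (ℕP.suc-injective (+-injective i≡))) j≤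

  nC∈Y⊎row≤0 : ∀ {u} → u ∈Y sh → (nC u ∈Y sh) ⊎ (row (nC u) ≤ 0ℤ)
  nC∈Y⊎row≤0 {i , j} u∈ with 1ℤ ≤? i - 1ℤ
  ... | yes 1≤i-1 = inj₁ (∈Y-downClosed u∈ 1≤i-1 (<⇒≤ (i-1<i i)) (∈Y⇒1≤col u∈) ≤-refl)
  ... | no 1≰i-1 = inj₂ (<+1⇒≤ (≰⇒> 1≰i-1))

  wC∈Y⊎col≤0 : ∀ {u} → u ∈Y sh → (wC u ∈Y sh) ⊎ (col (wC u) ≤ 0ℤ)
  wC∈Y⊎col≤0 {i , j} u∈ with 1ℤ ≤? j - 1ℤ
  ... | yes 1≤j-1 = inj₁ (∈Y-downClosed u∈ (∈Y⇒1≤row u∈) ≤-refl 1≤j-1 (<⇒≤ (i-1<i j)))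
  ... | no 1≰j-1 = inj₂ (<+1⇒≤ (≰⇒> 1≰j-1))

  content-minimal : ∀ {x} → x ∈Y sh → col x ≤ 1ℤ → ¬ (sC x ∈Y sh) →
                    ∀ {y} → y ∈Y sh → content x ≤ content y
  content-minimal {x} x∈ colx≤1 sx∉ {y} y∈ =
    +-mono-≤ (≤-trans colx≤1 (∈Y⇒1≤col y∈)) (neg-mono-≤ rowy≤rowx)
    where
    rowy≤rowx : row y ≤ row x
    rowy≤rowx with <-cmp (row x) (row y)
    ... | tri< x<y _ _ = ⊥-elim (sx∉ (∈Y-downClosed y∈ (≤-trans (∈Y⇒1≤row x∈) (<⇒≤ (i<i+1 _)))
                           (<⇒+1≤ x<y) (∈Y⇒1≤col x∈) (≤-trans colx≤1 (∈Y⇒1≤col y∈))))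
    ... | tri≈ _ x≡y _ = ≤-reflexive (sym x≡y)
    ... | tri> _ _ y<x = <⇒≤ y<x

  eC∉⇒eC-sC∉ : ∀ {u} → u ∈Y sh → ¬ (eC u ∈Y sh) → ¬ (eC (sC u) ∈Y sh)
  eC∉⇒eC-sC∉ {i , j} u∈ eu∉ esu∈ = eu∉ (∈Y-downClosed esu∈ (∈Y⇒1≤row u∈) (<⇒≤ (i<i+1 i))
    (≤-trans (∈Y⇒1≤col u∈) (<⇒≤ (i<i+1 j))) ≤-refl)

  diagonal-step : ∀ {x y} → content y ≡ content x → row y < row x → col y + 1ℤ ≤ col x
  diagonal-step {p , q} {a , b} b-a≡q-p a<p = subst₂ _≤_
    (trans (cong (_+ (a + 1ℤ)) (sym b-a≡q-p)) (shift b a)) (cancel q p)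
    (+-monoʳ-≤ (q - p) (<⇒+1≤ a<p))
    where
    shift : ∀ b a → (b - a) + (a + 1ℤ) ≡ b + 1ℤ
    shift = solve-∀
    cancel : ∀ q p → (q - p) + p ≡ q
    cancel = solve-∀

  diagonal-eC∈Y : ∀ {x y} → x ∈Y sh → y ∈Y sh → content y ≡ content x → row y < row x → eC y ∈Y sh
  diagonal-eC∈Y {x} {y} x∈ y∈ c≡ y<x = ∈Y-downClosed x∈ (∈Y⇒1≤row y∈) (<⇒≤ y<x)
    (≤-trans (∈Y⇒1≤col y∈) (<⇒≤ (i<i+1 (col y)))) (diagonal-step {x} {y} c≡ y<x)

  diagonal-eC-sC∈Y : ∀ {x y} → x ∈Y sh → y ∈Y sh → content y ≡ content x → row y < row x → eC (sC y) ∈Y sh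
  diagonal-eC-sC∈Y {x} {y} x∈ y∈ c≡ y<x = ∈Y-downClosed x∈
    (≤-trans (∈Y⇒1≤row y∈) (<⇒≤ (i<i+1 (row y)))) (<⇒+1≤ y<x)
    (≤-trans (∈Y⇒1≤col y∈) (<⇒≤ (i<i+1 (col y)))) (diagonal-step {x} {y} c≡ y<x)

  Rim : Cell → Set
  Rim w = (w ∈Y sh) × ¬ (eC (sC w) ∈Y sh)

  Rim-content-injective : ∀ {x y} → Rim x → Rim y → content x ≡ content y → x ≡ y
  Rim-content-injective {x} {y} (x∈ , x-rim) (y∈ , y-rim) c≡ with <-cmp (row x) (row y)
  ... | tri< x<y _ _ = ⊥-elim (x-rim (diagonal-eC-sC∈Y y∈ x∈ c≡ x<y))
  ... | tri≈ _ x≡y _ = row-content-injective x≡y c≡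
  ... | tri> _ _ y<x = ⊥-elim (y-rim (diagonal-eC-sC∈Y x∈ y∈ (sym c≡) y<x))

-- The content classes 𝓞, 𝓘, 𝓐, 𝓑 of o₁ < i₁ < o₂ < … < iᵣ < o_{r+1}

Within : ℤ → ℤ × ℤ → Set
Within c (a , b) = (a < c) × (c < b)

lastOf : ℤ → List ℤ → ℤ
lastOf o outs = foldl (λ _ x → x) o outs

IsO : ℤ → List ℤ → ℤ → Set
IsO o outs c = c ∈ (o ∷ outs)

IsI : List ℤ → ℤ → Set
IsI ins c = c ∈ ins

IsA : ℤ → List ℤ → List ℤ → ℤ → Set
IsA o outs ins c = (c < o) ⊎ Any (Within c) (zip ins outs)

IsB : ℤ → List ℤ → List ℤ → ℤ → Set
IsB o outs ins c = Any (Within c) (zip (o ∷ outs) ins) ⊎ (lastOf o outs < c)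

private variable
  o : ℤ
  outs ins : List ℤ

o<os : Interleave o outs ins → ∀ {x} → x ∈ outs → o < x
o<os {outs = _ ∷ _} {ins = _ ∷ _} (o<i , i<o' , _) (here refl) = <-trans o<i i<o'
o<os {outs = _ ∷ _} {ins = _ ∷ _} (o<i , i<o' , il) (there x∈) = <-trans (<-trans o<i i<o') (o<os il x∈)

o<is : Interleave o outs ins → ∀ {x} → x ∈ ins → o < x
o<is {outs = _ ∷ _} {ins = _ ∷ _} (o<i , _ , _) (here refl) = o<i
o<is {outs = _ ∷ _} {ins = _ ∷ _} (o<i , i<o' , il) (there x∈) = <-trans (<-trans o<i i<o') (o<is il x∈)

o≤O : Interleave o outs ins → ∀ {x} → IsO o outs x → o ≤ x
o≤O _ (here refl) = ≤-refl
o≤O il (there x∈) = <⇒≤ (o<os il x∈)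

o<zipA : Interleave o outs ins → ∀ {c} → Any (Within c) (zip ins outs) → o < c
o<zipA {outs = _ ∷ _} {ins = _ ∷ _} (o<i , _ , _) (here (i<c , _)) = <-trans o<i i<c
o<zipA {outs = _ ∷ _} {ins = _ ∷ _} (o<i , i<o' , il) (there c∈) = <-trans (<-trans o<i i<o') (o<zipA il c∈)

o<zipB : Interleave o outs ins → ∀ {c} → Any (Within c) (zip (o ∷ outs) ins) → o < c
o<zipB {outs = _ ∷ _} {ins = _ ∷ _} _ (here (o<c , _)) = o<c
o<zipB {outs = _ ∷ _} {ins = _ ∷ _} (o<i , i<o' , il) (there c∈) = <-trans (<-trans o<i i<o') (o<zipB il c∈)

o≤last : Interleave o outs ins → o ≤ lastOf o outs
o≤last {outs = []} {ins = []} _ = ≤-refl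
o≤last {outs = _ ∷ _} {ins = _ ∷ _} (o<i , i<o' , il) = ≤-trans (<⇒≤ (<-trans o<i i<o')) (o≤last il)

O≤last : Interleave o outs ins → ∀ {x} → IsO o outs x → x ≤ lastOf o outs
O≤last il (here refl) = o≤last il
O≤last {outs = _ ∷ _} {ins = _ ∷ _} (_ , _ , il) (there x∈) = O≤last il x∈

I<last : Interleave o outs ins → ∀ {x} → IsI ins x → x < lastOf o outs
I<last {outs = _ ∷ _} {ins = _ ∷ _} (_ , i<o' , il) (here refl) = <-≤-trans i<o' (o≤last il)
I<last {outs = _ ∷ _} {ins = _ ∷ _} (_ , _ , il) (there x∈) = I<last il x∈

zipA<last : Interleave o outs ins → ∀ {c} → Any (Within c) (zip ins outs) → c < lastOf o outs
zipA<last {outs = _ ∷ _} {ins = _ ∷ _} (_ , _ , il) (here (_ , c<o')) = <-≤-trans c<o' (o≤last il)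
zipA<last {outs = _ ∷ _} {ins = _ ∷ _} (_ , _ , il) (there c∈) = zipA<last il c∈

classify : Interleave o outs ins → ∀ c →
           IsO o outs c ⊎ IsI ins c ⊎ IsA o outs ins c ⊎ IsB o outs ins c
classify {o} il c with <-cmp c o
... | tri< c<o _ _ = inj₂ (inj₂ (inj₁ (inj₁ c<o)))
... | tri≈ _ refl _ = inj₁ (here refl)
... | tri> _ _ o<c = above _ _ il o<c
  where
  above : ∀ outs ins → Interleave o outs ins → o < c →
          IsO o outs c ⊎ IsI ins c ⊎ IsA o outs ins c ⊎ IsB o outs ins c
  above [] [] _ o<c = inj₂ (inj₂ (inj₂ (inj₂ o<c)))
  above (o' ∷ outs) (i ∷ ins) (_ , _ , il) o<c with <-cmp c i
  ... | tri< c<i _ _ = inj₂ (inj₂ (inj₂ (inj₁ (here (o<c , c<i)))))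
  ... | tri≈ _ refl _ = inj₂ (inj₁ (here refl))
  ... | tri> _ _ i<c with <-cmp c o'
  ...   | tri< c<o' _ _ = inj₂ (inj₂ (inj₁ (inj₂ (here (i<c , c<o')))))
  ...   | tri≈ _ refl _ = inj₁ (there (here refl))
  ...   | tri> _ _ o'<c with classify il c
  ...     | inj₁ c∈O = inj₁ (there c∈O)
  ...     | inj₂ (inj₁ c∈I) = inj₂ (inj₁ (there c∈I))
  ...     | inj₂ (inj₂ (inj₁ (inj₁ c<o'))) = ⊥-elim (<-asym c<o' o'<c)
  ...     | inj₂ (inj₂ (inj₁ (inj₂ c∈A))) = inj₂ (inj₂ (inj₁ (inj₂ (there c∈A))))
  ...     | inj₂ (inj₂ (inj₂ (inj₁ c∈B))) = inj₂ (inj₂ (inj₂ (inj₁ (there c∈B))))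
  ...     | inj₂ (inj₂ (inj₂ (inj₂ last<c))) = inj₂ (inj₂ (inj₂ (inj₂ last<c)))

disjoint-O-I : Interleave o outs ins → ∀ {c} → IsO o outs c → IsI ins c → ⊥
disjoint-O-I il (here refl) c∈I = <-irrefl refl (o<is il c∈I)
disjoint-O-I {outs = _ ∷ _} {ins = _ ∷ _} (_ , i<o' , il) (there c∈O) (here refl) =
  <-irrefl refl (<-≤-trans i<o' (o≤O il c∈O))
disjoint-O-I {outs = _ ∷ _} {ins = _ ∷ _} (_ , _ , il) (there c∈O) (there c∈I) = disjoint-O-I il c∈O c∈I

disjoint-O-A : Interleave o outs ins → ∀ {c} → IsO o outs c → IsA o outs ins c → ⊥
disjoint-O-A _ (here refl) (inj₁ c<o) = <-irrefl refl c<o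
disjoint-O-A il (here refl) (inj₂ c∈A) = <-irrefl refl (o<zipA il c∈A)
disjoint-O-A il (there c∈O) (inj₁ c<o) = <-asym c<o (o<os il c∈O)
disjoint-O-A {outs = _ ∷ _} {ins = _ ∷ _} (_ , _ , il) (there c∈O) (inj₂ (here (_ , c<o'))) =
  <-irrefl refl (<-≤-trans c<o' (o≤O il c∈O))
disjoint-O-A {outs = _ ∷ _} {ins = _ ∷ _} (_ , _ , il) (there c∈O) (inj₂ (there c∈A)) =
  disjoint-O-A il c∈O (inj₂ c∈A)

disjoint-O-B : Interleave o outs ins → ∀ {c} → IsO o outs c → IsB o outs ins c → ⊥
disjoint-O-B il (here refl) (inj₁ c∈B) = <-irrefl refl (o<zipB il c∈B)
disjoint-O-B il (here refl) (inj₂ last<c) = <-irrefl refl (≤-<-trans (o≤last il) last<c)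
disjoint-O-B il (there c∈O) (inj₂ last<c) = <-irrefl refl (≤-<-trans (O≤last il (there c∈O)) last<c)
disjoint-O-B {outs = _ ∷ _} {ins = _ ∷ _} (_ , i<o' , il) (there c∈O) (inj₁ (here (_ , c<i))) =
  <-asym c<i (<-≤-trans i<o' (o≤O il c∈O))
disjoint-O-B {outs = _ ∷ _} {ins = _ ∷ _} (_ , _ , il) (there c∈O) (inj₁ (there c∈B)) =
  disjoint-O-B il c∈O (inj₁ c∈B)

disjoint-I-A : Interleave o outs ins → ∀ {c} → IsI ins c → IsA o outs ins c → ⊥
disjoint-I-A il c∈I (inj₁ c<o) = <-asym c<o (o<is il c∈I)
disjoint-I-A {outs = _ ∷ _} {ins = _ ∷ _} _ (here refl) (inj₂ (here (i<c , _))) = <-irrefl refl i<c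
disjoint-I-A {outs = _ ∷ _} {ins = _ ∷ _} (_ , _ , il) (there c∈I) (inj₂ (here (_ , c<o'))) =
  <-asym c<o' (o<is il c∈I)
disjoint-I-A {outs = _ ∷ _} {ins = _ ∷ _} (_ , i<o' , il) (here refl) (inj₂ (there c∈A)) =
  <-asym i<o' (o<zipA il c∈A)
disjoint-I-A {outs = _ ∷ _} {ins = _ ∷ _} (_ , _ , il) (there c∈I) (inj₂ (there c∈A)) =
  disjoint-I-A il c∈I (inj₂ c∈A)

disjoint-I-B : Interleave o outs ins → ∀ {c} → IsI ins c → IsB o outs ins c → ⊥
disjoint-I-B il c∈I (inj₂ last<c) = <-asym last<c (I<last il c∈I)
disjoint-I-B {outs = _ ∷ _} {ins = _ ∷ _} _ (here refl) (inj₁ (here (_ , c<i))) = <-irrefl refl c<i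
disjoint-I-B {outs = _ ∷ _} {ins = _ ∷ _} (_ , i<o' , il) (there c∈I) (inj₁ (here (_ , c<i))) =
  <-asym c<i (<-trans i<o' (o<is il c∈I))
disjoint-I-B {outs = _ ∷ _} {ins = _ ∷ _} (_ , i<o' , il) (here refl) (inj₁ (there c∈B)) =
  <-asym i<o' (o<zipB il c∈B)
disjoint-I-B {outs = _ ∷ _} {ins = _ ∷ _} (_ , _ , il) (there c∈I) (inj₁ (there c∈B)) =
  disjoint-I-B il c∈I (inj₁ c∈B)

disjoint-A-B : Interleave o outs ins → ∀ {c} → IsA o outs ins c → IsB o outs ins c → ⊥
disjoint-A-B il (inj₁ c<o) (inj₁ c∈B) = <-asym c<o (o<zipB il c∈B)
disjoint-A-B il (inj₁ c<o) (inj₂ last<c) = <-asym c<o (≤-<-trans (o≤last il) last<c)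
disjoint-A-B il (inj₂ c∈A) (inj₂ last<c) = <-asym last<c (zipA<last il c∈A)
disjoint-A-B {outs = _ ∷ _} {ins = _ ∷ _} _ (inj₂ (here (i<c , _))) (inj₁ (here (_ , c<i))) = <-asym i<c c<i
disjoint-A-B {outs = _ ∷ _} {ins = _ ∷ _} (_ , _ , il) (inj₂ (here (_ , c<o'))) (inj₁ (there c∈B)) =
  <-asym c<o' (o<zipB il c∈B)
disjoint-A-B {outs = _ ∷ _} {ins = _ ∷ _} (_ , i<o' , il) (inj₂ (there c∈A)) (inj₁ (here (_ , c<i))) =
  <-asym c<i (<-trans i<o' (o<zipA il c∈A))
disjoint-A-B {outs = _ ∷ _} {ins = _ ∷ _} (_ , _ , il) (inj₂ (there c∈A)) (inj₁ (there c∈B)) =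
  disjoint-A-B il (inj₂ c∈A) (inj₁ c∈B)

B⊎I-cons : ∀ {o o' outs i ins x} → IsB o' outs ins x ⊎ IsI ins x →
           IsB o (o' ∷ outs) (i ∷ ins) x ⊎ IsI (i ∷ ins) x
B⊎I-cons (inj₁ (inj₁ x∈B)) = inj₁ (inj₁ (there x∈B))
B⊎I-cons (inj₁ (inj₂ last<x)) = inj₁ (inj₂ last<x)
B⊎I-cons (inj₂ x∈I) = inj₂ (there x∈I)

A⊎O-cons : ∀ {o o' outs i ins x} → i < x → IsA o' outs ins x ⊎ IsO o' outs x →
           IsA o (o' ∷ outs) (i ∷ ins) x ⊎ IsO o (o' ∷ outs) x
A⊎O-cons i<x (inj₁ (inj₁ x<o')) = inj₁ (inj₂ (here (i<x , x<o')))
A⊎O-cons _ (inj₁ (inj₂ x∈A)) = inj₁ (inj₂ (there x∈A))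
A⊎O-cons _ (inj₂ x∈O) = inj₂ (there x∈O)

O⊎B⇒suc∈B⊎I : Interleave o outs ins → ∀ {c} →
              IsO o outs c ⊎ IsB o outs ins c → IsB o outs ins (c + 1ℤ) ⊎ IsI ins (c + 1ℤ)
O⊎B⇒suc∈B⊎I {o} {[]} {[]} _ (inj₁ (here refl)) = inj₁ (inj₂ (i<i+1 o))
O⊎B⇒suc∈B⊎I {outs = []} {ins = []} _ (inj₂ (inj₂ last<c)) = inj₁ (inj₂ (<-trans last<c (i<i+1 _)))
O⊎B⇒suc∈B⊎I {o} {o' ∷ outs} {i ∷ ins} (o<i , _ , il) = step
  where
  belowI : ∀ {c} → o < c + 1ℤ → c < i →
           IsB o (o' ∷ outs) (i ∷ ins) (c + 1ℤ) ⊎ IsI (i ∷ ins) (c + 1ℤ)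
  belowI o<c+1 c<i with ≤⇒<⊎≡ (<⇒+1≤ c<i)
  ... | inj₁ c+1<i = inj₁ (inj₁ (here (o<c+1 , c+1<i)))
  ... | inj₂ c+1≡i = inj₂ (here c+1≡i)
  step : ∀ {c} → IsO o (o' ∷ outs) c ⊎ IsB o (o' ∷ outs) (i ∷ ins) c →
         IsB o (o' ∷ outs) (i ∷ ins) (c + 1ℤ) ⊎ IsI (i ∷ ins) (c + 1ℤ)
  step (inj₁ (here refl)) = belowI (i<i+1 o) o<i
  step (inj₁ (there c∈O)) = B⊎I-cons (O⊎B⇒suc∈B⊎I il (inj₁ c∈O))
  step (inj₂ (inj₁ (here (o<c , c<i)))) = belowI (<-trans o<c (i<i+1 _)) c<i
  step (inj₂ (inj₁ (there c∈B))) = B⊎I-cons (O⊎B⇒suc∈B⊎I il (inj₂ (inj₁ c∈B)))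
  step (inj₂ (inj₂ last<c)) = B⊎I-cons (O⊎B⇒suc∈B⊎I il (inj₂ (inj₂ last<c)))

A⊎I⇒suc∈A⊎O : Interleave o outs ins → ∀ {c} →
              IsA o outs ins c ⊎ IsI ins c → IsA o outs ins (c + 1ℤ) ⊎ IsO o outs (c + 1ℤ)
A⊎I⇒suc∈A⊎O _ (inj₁ (inj₁ c<o)) with ≤⇒<⊎≡ (<⇒+1≤ c<o)
... | inj₁ c+1<o = inj₁ (inj₁ c+1<o)
... | inj₂ c+1≡o = inj₂ (here c+1≡o)
A⊎I⇒suc∈A⊎O {outs = _ ∷ _} {ins = _ ∷ _} _ (inj₁ (inj₂ (here (i<c , c<o')))) with ≤⇒<⊎≡ (<⇒+1≤ c<o')
... | inj₁ c+1<o' = inj₁ (inj₂ (here (<-trans i<c (i<i+1 _) , c+1<o')))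
... | inj₂ c+1≡o' = inj₂ (there (here c+1≡o'))
A⊎I⇒suc∈A⊎O {outs = _ ∷ _} {ins = _ ∷ _} (_ , i<o' , il) {c} (inj₁ (inj₂ (there c∈A))) =
  A⊎O-cons (<-trans (<-trans i<o' (o<zipA il c∈A)) (i<i+1 c)) (A⊎I⇒suc∈A⊎O il (inj₁ (inj₂ c∈A)))
A⊎I⇒suc∈A⊎O {outs = _ ∷ _} {ins = _ ∷ _} (_ , i<o' , _) {c} (inj₂ (here refl)) with ≤⇒<⊎≡ (<⇒+1≤ i<o')
... | inj₁ c+1<o' = inj₁ (inj₂ (here (i<i+1 c , c+1<o')))
... | inj₂ c+1≡o' = inj₂ (there (here c+1≡o'))
A⊎I⇒suc∈A⊎O {outs = _ ∷ _} {ins = _ ∷ _} (_ , i<o' , il) {c} (inj₂ (there c∈I)) =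
  A⊎O-cons (<-trans (<-trans i<o' (o<is il c∈I)) (i<i+1 c)) (A⊎I⇒suc∈A⊎O il (inj₂ c∈I))

-- The rim of λ

module Rims {sh : List ℕ} (isP : IsPartition sh) (K : Corners sh) where
  open Diagram isP

  private
    il : Interleave (o₁ K) (os K) (is K)
    il = interleave K

  𝓞 𝓘 𝓐 𝓑 : ℤ → Set
  𝓞 = IsO (o₁ K) (os K)
  𝓘 = IsI (is K)
  𝓐 = IsA (o₁ K) (os K) (is K)
  𝓑 = IsB (o₁ K) (os K) (is K)

  disjoint-𝓞𝓑-𝓘𝓐 : ∀ {c} → 𝓞 c ⊎ 𝓑 c → 𝓘 c ⊎ 𝓐 c → ⊥
  disjoint-𝓞𝓑-𝓘𝓐 (inj₁ c∈O) (inj₁ c∈I) = disjoint-O-I il c∈O c∈I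
  disjoint-𝓞𝓑-𝓘𝓐 (inj₁ c∈O) (inj₂ c∈A) = disjoint-O-A il c∈O c∈A
  disjoint-𝓞𝓑-𝓘𝓐 (inj₂ c∈B) (inj₁ c∈I) = disjoint-I-B il c∈I c∈B
  disjoint-𝓞𝓑-𝓘𝓐 (inj₂ c∈B) (inj₂ c∈A) = disjoint-A-B il c∈A c∈B

  disjoint-𝓞𝓐-𝓘𝓑 : ∀ {c} → 𝓞 c ⊎ 𝓐 c → 𝓘 c ⊎ 𝓑 c → ⊥
  disjoint-𝓞𝓐-𝓘𝓑 (inj₁ c∈O) (inj₁ c∈I) = disjoint-O-I il c∈O c∈I
  disjoint-𝓞𝓐-𝓘𝓑 (inj₁ c∈O) (inj₂ c∈B) = disjoint-O-B il c∈O c∈B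
  disjoint-𝓞𝓐-𝓘𝓑 (inj₂ c∈A) (inj₁ c∈I) = disjoint-I-A il c∈I c∈A
  disjoint-𝓞𝓐-𝓘𝓑 (inj₂ c∈A) (inj₂ c∈B) = disjoint-A-B il c∈A c∈B

  𝓘𝓐-class : ∀ {v} → inI K v ⊎ inA K v → 𝓘 (content v) ⊎ 𝓐 (content v)
  𝓘𝓐-class (inj₁ (_ , c∈I)) = inj₁ c∈I
  𝓘𝓐-class (inj₂ (_ , c∈A)) = inj₂ c∈A

  𝓞𝓑-class : ∀ {v} → inO K v ⊎ inB K v → 𝓞 (content v) ⊎ 𝓑 (content v)
  𝓞𝓑-class (inj₁ (_ , c∈O)) = inj₁ c∈O
  𝓞𝓑-class (inj₂ (_ , c∈B)) = inj₂ c∈B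

  𝓘𝓐⇒next-𝓞𝓐 : ∀ d v → 𝓘 (content v) ⊎ 𝓐 (content v) →
               𝓞 (content (move d v)) ⊎ 𝓐 (content (move d v))
  𝓘𝓐⇒next-𝓞𝓐 d v c∈IA =
    subst (λ c → 𝓞 c ⊎ 𝓐 c) (sym (content-move d v)) (swap (A⊎I⇒suc∈A⊎O il (swap c∈IA)))

  OuterCorner⇒Rim : ∀ {z} → OuterCorner sh z → Rim z
  OuterCorner⇒Rim (z∈ , ez∉ , _) = z∈ , eC∉⇒eC-sC∉ z∈ ez∉

  InnerCorner⇒Rim : ∀ {z} → InnerCorner sh z → Rim z
  InnerCorner⇒Rim (z∈ , _ , _ , esz∉) = z∈ , esz∉

  Rim-eC∉⇒¬𝓘 : ∀ {w} → Rim w → ¬ (eC w ∈Y sh) → ¬ 𝓘 (content w)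
  Rim-eC∉⇒¬𝓘 w-rim ew∉ c∈I with →inner K _ c∈I
  ... | z , z-inner , cz≡ with Rim-content-injective (InnerCorner⇒Rim z-inner) w-rim cz≡
  ... | refl = ew∉ (proj₁ (proj₂ z-inner))

  Rim-eC∈⇒¬𝓞 : ∀ {w} → Rim w → eC w ∈Y sh → ¬ 𝓞 (content w)
  Rim-eC∈⇒¬𝓞 w-rim ew∈ c∈O with →outer K _ c∈O
  ... | z , z-outer , cz≡ with Rim-content-injective (OuterCorner⇒Rim z-outer) w-rim cz≡
  ... | refl = proj₁ (proj₂ z-outer) ew∈

  -- Below w the rim runs down to an outer corner, of content some o_k.
  Rim-vertical⇒𝓑 : ∀ n {w} → + length sh - row w ≤ + n → Rim w →
                   sC w ∈Y sh → ¬ (eC w ∈Y sh) → 𝓑 (content w)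
  Rim-vertical⇒𝓑 ℕ.zero {w} fuel _ sw∈ _ =
    ⊥-elim (fuel-exhausted fuel (i<i+1 (row w)) (row≤length sw∈))
  Rim-vertical⇒𝓑 (ℕ.suc n) {w} fuel w-rim@(w∈ , esw∉) sw∈ ew∉ = fromSouth (O⊎B⇒suc∈B⊎I il south)
    where
    south : 𝓞 (content (sC w)) ⊎ 𝓑 (content (sC w))
    south with sC (sC w) ∈Y?
    ... | no ssw∉ = inj₁ (outer→ K (sC w) (sw∈ , esw∉ , ssw∉))
    ... | yes ssw∈ = inj₂ (Rim-vertical⇒𝓑 n (fuel-pred-sub {+ length sh} {row w} refl fuel)
                            (sw∈ , eC∉⇒eC-sC∉ sw∈ esw∉) ssw∈ esw∉)
    fromSouth : 𝓑 (content (sC w) + 1ℤ) ⊎ 𝓘 (content (sC w) + 1ℤ) → 𝓑 (content w)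
    fromSouth (inj₁ c∈B) = subst 𝓑 (content-sC+1 w) c∈B
    fromSouth (inj₂ c∈I) = ⊥-elim (Rim-eC∉⇒¬𝓘 w-rim ew∉ (subst 𝓘 (content-sC+1 w) c∈I))

  Rim-leftmost⇒<o₁ : ∀ {w} → Rim w → col w ≤ 1ℤ → ¬ (sC w ∈Y sh) → eC w ∈Y sh → content w < o₁ K
  Rim-leftmost⇒<o₁ {w} w-rim@(w∈ , _) colw≤1 sw∉ ew∈ with →outer K (o₁ K) (here refl)
  ... | z , z-outer@(z∈ , ez∉ , _) , refl
    with ≤⇒<⊎≡ (content-minimal w∈ colw≤1 sw∉ z∈)
  ... | inj₁ cw<cz = cw<cz
  ... | inj₂ cw≡cz with Rim-content-injective w-rim (OuterCorner⇒Rim z-outer) cw≡cz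
  ... | refl = ⊥-elim (ez∉ ew∈)

  -- West of w the rim runs to an inner corner or to the first column.
  Rim-horizontal⇒𝓐 : ∀ n {w} → col w ≤ + n → Rim w →
                     ¬ (sC w ∈Y sh) → eC w ∈Y sh → 𝓐 (content w)
  Rim-horizontal⇒𝓐 ℕ.zero fuel (w∈ , _) _ _ = ⊥-elim (1≰0 (∈Y⇒1≤col w∈) fuel)
  Rim-horizontal⇒𝓐 (ℕ.suc n) {w} fuel w-rim@(w∈ , _) sw∉ ew∈ with wC∈Y⊎col≤0 w∈
  ... | inj₂ colww≤0 = inj₁ (Rim-leftmost⇒<o₁ w-rim (-1-cancel-≤ colww≤0) sw∉ ew∈)
  ... | inj₁ ww∈ = fromWest (A⊎I⇒suc∈A⊎O il west)
    where
    eww∈ : eC (wC w) ∈Y sh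
    eww∈ = subst (_∈Y sh) (sym (eC-wC w)) w∈
    esww∉ : ¬ (eC (sC (wC w)) ∈Y sh)
    esww∉ = subst (λ x → ¬ (x ∈Y sh)) (sym (eC-sC-wC w)) sw∉
    west : 𝓐 (content (wC w)) ⊎ 𝓘 (content (wC w))
    west with sC (wC w) ∈Y?
    ... | yes sww∈ = inj₂ (inner→ K (wC w) (ww∈ , eww∈ , sww∈ , esww∉))
    ... | no sww∉ = inj₁ (Rim-horizontal⇒𝓐 n (fuel-pred fuel) (ww∈ , esww∉) sww∉ eww∈)
    fromWest : 𝓐 (content (wC w) + 1ℤ) ⊎ 𝓞 (content (wC w) + 1ℤ) → 𝓐 (content w)
    fromWest (inj₁ c∈A) = subst 𝓐 (content-wC+1 w) c∈A
    fromWest (inj₂ c∈O) = ⊥-elim (Rim-eC∈⇒¬𝓞 w-rim ew∈ (subst 𝓞 (content-wC+1 w) c∈O))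

  Rim-sC∉⇒𝓞⊎𝓐 : ∀ {w} → Rim w → ¬ (sC w ∈Y sh) → 𝓞 (content w) ⊎ 𝓐 (content w)
  Rim-sC∉⇒𝓞⊎𝓐 {w} w-rim@(w∈ , _) sw∉ with eC w ∈Y?
  ... | yes ew∈ =
    inj₂ (Rim-horizontal⇒𝓐 _ (≤+∣∣ (≤-trans (+≤+ ℕ.z≤n) (∈Y⇒1≤col w∈))) w-rim sw∉ ew∈)
  ... | no ew∉ = inj₁ (outer→ K w (w∈ , ew∉ , sw∉))

  Rim-sC∈⇒𝓘⊎𝓑 : ∀ {w} → Rim w → sC w ∈Y sh → 𝓘 (content w) ⊎ 𝓑 (content w)
  Rim-sC∈⇒𝓘⊎𝓑 {w} w-rim@(w∈ , esw∉) sw∈ with eC w ∈Y?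
  ... | yes ew∈ = inj₁ (inner→ K w (w∈ , ew∈ , sw∈ , esw∉))
  ... | no ew∉ = inj₂ (Rim-vertical⇒𝓑 _ (≤+∣∣ (i≤j⇒0≤j-i (row≤length w∈))) w-rim sw∈ ew∉)

  Rim-eC∉⇒𝓞⊎𝓑 : ∀ {w} → Rim w → ¬ (eC w ∈Y sh) → 𝓞 (content w) ⊎ 𝓑 (content w)
  Rim-eC∉⇒𝓞⊎𝓑 {w} w-rim@(w∈ , _) ew∉ with sC w ∈Y?
  ... | yes sw∈ = inj₂ (Rim-vertical⇒𝓑 _ (≤+∣∣ (i≤j⇒0≤j-i (row≤length w∈))) w-rim sw∈ ew∉)
  ... | no sw∉ = inj₁ (outer→ K w (w∈ , ew∉ , sw∉))

  Rim-𝓞⊎𝓐⇒sC∉ : ∀ {w} → Rim w → 𝓞 (content w) ⊎ 𝓐 (content w) → ¬ (sC w ∈Y sh)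
  Rim-𝓞⊎𝓐⇒sC∉ w-rim c∈OA sw∈ = disjoint-𝓞𝓐-𝓘𝓑 c∈OA (Rim-sC∈⇒𝓘⊎𝓑 w-rim sw∈)

  rimOnDiagonal : ∀ n {v} → + length sh - row v ≤ + n → v ∈Y sh →
                  Σ Cell λ w → Rim w × (content w ≡ content v) × (row v ≤ row w)
  rimOnDiagonal n {v} fuel v∈ with eC (sC v) ∈Y? | n
  ... | no esv∉ | _ = v , (v∈ , esv∉) , refl , ≤-refl
  ... | yes esv∈ | ℕ.zero = ⊥-elim (fuel-exhausted fuel (i<i+1 (row v)) (row≤length esv∈))
  ... | yes esv∈ | ℕ.suc n
    with rimOnDiagonal n (fuel-pred-sub {+ length sh} {row v} refl fuel) esv∈
  ...   | w , w-rim , cw≡ , row≤ = w , w-rim , trans cw≡ (content-eC-sC v) , ≤-trans (<⇒≤ (i<i+1 _)) row≤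

  𝓘⊎𝓐⇒eC∈Y : ∀ {v} → v ∈Y sh → 𝓘 (content v) ⊎ 𝓐 (content v) → eC v ∈Y sh
  𝓘⊎𝓐⇒eC∈Y {v} v∈ c∈IA with eC v ∈Y?
  ... | yes ev∈ = ev∈
  ... | no ev∉ with rimOnDiagonal _ (≤+∣∣ (i≤j⇒0≤j-i (row≤length v∈))) v∈
  ...   | w , w-rim@(w∈ , _) , cw≡ , rowv≤roww with ≤⇒<⊎≡ rowv≤roww
  ...     | inj₁ rowv<roww = ⊥-elim (ev∉ (diagonal-eC∈Y w∈ v∈ (sym cw≡) rowv<roww))
  ...     | inj₂ rowv≡roww = ⊥-elim (disjoint-𝓞𝓑-𝓘𝓐 (Rim-eC∉⇒𝓞⊎𝓑 v-rim ev∉) c∈IA)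
    where
    v-rim : Rim v
    v-rim = subst Rim (row-content-injective {w} {v} (sym rowv≡roww) cw≡) w-rim

  rimPathEndingAt : ∀ k {x} → Rim x → ∀ {y} → y ∈Y sh → content y ≡ content x - + k →
                    PathEndingAt Rim x k
  rimPathEndingAt ℕ.zero {x} x-rim _ _ = (x , []) , refl , refl , x-rim ∷ []
  rimPathEndingAt (ℕ.suc k) {x} x-rim@(x∈ , esx∉) {y} y∈ cy≡ with sC x ∈Y?
  ... | yes sx∈ = snoc-PathEndingAt N (nC-sC x) x-rim
        (rimPathEndingAt k (sx∈ , eC∉⇒eC-sC∉ sx∈ esx∉) y∈
                         (trans cy≡ (sub-suc {c' = content (sC x)} k (content-sC+1 x))))
  ... | no sx∉ with wC∈Y⊎col≤0 x∈
  ...   | inj₁ wx∈ = snoc-PathEndingAt E (eC-wC x) x-rim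
          (rimPathEndingAt k (wx∈ , subst (λ z → ¬ (z ∈Y sh)) (sym (eC-sC-wC x)) sx∉) y∈
                           (trans cy≡ (sub-suc {c' = content (wC x)} k (content-wC+1 x))))
  ...   | inj₂ colwx≤0 =
    ⊥-elim (<-irrefl refl (<-≤-trans cy<cx (content-minimal x∈ (-1-cancel-≤ colwx≤0) sx∉ y∈)))
    where
    cy<cx : content y < content x
    cy<cx = subst (_< content x) (sym cy≡) (i-suc<i (content x) k)

-- Reverse plane partitions and candidates

ext-inside : ∀ (f : Cell → ℤ) {i j} → 1ℤ ≤ i → 1ℤ ≤ j → ext f (i , j) ≡ f (i , j)
ext-inside f {+ ℕ.suc _} {+ ℕ.suc _} _ _ = refl
ext-inside f {+ ℕ.zero} (+≤+ ()) _
ext-inside f {+ ℕ.suc _} {+ ℕ.zero} _ (+≤+ ())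

ext-row≤0 : ∀ (f : Cell → ℤ) {i j} → i ≤ 0ℤ → ext f (i , j) ≡ 0ℤ
ext-row≤0 f {+ ℕ.zero} _ = refl
ext-row≤0 f { -[1+ _ ]} _ = refl
ext-row≤0 f {+ ℕ.suc _} (+≤+ ())

ext-col≤0 : ∀ (f : Cell → ℤ) {i j} → j ≤ 0ℤ → ext f (i , j) ≡ 0ℤ
ext-col≤0 f {i} {j} j≤0 with i ≤ᵇ 0ℤ
... | true = refl
... | false = lemma j j≤0
  where
  lemma : ∀ j → j ≤ 0ℤ → (if j ≤ᵇ 0ℤ then 0ℤ else f (i , j)) ≡ 0ℤ
  lemma (+ ℕ.zero) _ = refl
  lemma -[1+ _ ] _ = refl
  lemma (+ ℕ.suc _) (+≤+ ())

IsRPP-cong : ∀ {sh f g} → (∀ y → y ∈Y sh → f y ≡ g y) → IsRPP sh g → IsRPP sh f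
IsRPP-cong f≗g g-rpp y y∈ with g-rpp y y∈
... | 0≤ , e≤ , s≤ = subst (0ℤ ≤_) (sym (f≗g y y∈)) 0≤ ,
  (λ ey∈ → subst₂ _≤_ (sym (f≗g y y∈)) (sym (f≗g (eC y) ey∈)) (e≤ ey∈)) ,
  (λ sy∈ → subst₂ _≤_ (sym (f≗g y y∈)) (sym (f≗g (sC y) sy∈)) (s≤ sy∈))

Eval⇒IsRPP : ∀ {sh} {K : Corners sh} {hs ρ} → Eval K hs ρ → IsRPP sh ρ
Eval⇒IsRPP (nil ρ≗0) y y∈ = ≤-reflexive (sym (ρ≗0 y y∈)) ,
  (λ ey∈ → ≤-reflexive (trans (ρ≗0 y y∈) (sym (ρ≗0 (eC y) ey∈)))) ,
  (λ sy∈ → ≤-reflexive (trans (ρ≗0 y y∈) (sym (ρ≗0 (sC y) sy∈))))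
Eval⇒IsRPP {sh} (cons _ (_ , _ , _ , _ , _ , rpp , agree)) = IsRPP-cong {sh} agree rpp

module Extension {sh : List ℕ} (isP : IsPartition sh) {π : Cell → ℤ} (rpp : IsRPP sh π) where
  open Diagram isP

  ext-∈Y : ∀ {x} → x ∈Y sh → ext π x ≡ π x
  ext-∈Y {i , j} x∈ = ext-inside π (∈Y⇒1≤row x∈) (∈Y⇒1≤col x∈)

  ext-nC≤ : ∀ {v} → v ∈Y sh → ext π (nC v) ≤ π v
  ext-nC≤ {v} v∈ with nC∈Y⊎row≤0 v∈
  ... | inj₁ nv∈ = subst₂ _≤_ (sym (ext-∈Y nv∈)) (cong π (sC-nC v))
                     (proj₂ (proj₂ (rpp (nC v) nv∈)) (subst (_∈Y sh) (sym (sC-nC v)) v∈))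
  ... | inj₂ row≤0 = subst (_≤ π v) (sym (ext-row≤0 π row≤0)) (proj₁ (rpp v v∈))

  0≤ext-wC : ∀ {v} → v ∈Y sh → 0ℤ ≤ ext π (wC v)
  0≤ext-wC {v} v∈ with wC∈Y⊎col≤0 v∈
  ... | inj₁ wv∈ = subst (0ℤ ≤_) (sym (ext-∈Y wv∈)) (proj₁ (rpp _ wv∈))
  ... | inj₂ col≤0 = ≤-reflexive (sym (ext-col≤0 π col≤0))

  ext-nC-wC≤ext-wC : ∀ {v} → v ∈Y sh → ext π (nC (wC v)) ≤ ext π (wC v)
  ext-nC-wC≤ext-wC {v} v∈ with wC∈Y⊎col≤0 v∈
  ... | inj₁ wv∈ = subst (ext π (nC (wC v)) ≤_) (sym (ext-∈Y wv∈)) (ext-nC≤ wv∈)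
  ... | inj₂ col≤0 = ≤-reflexive (trans (ext-col≤0 π col≤0) (sym (ext-col≤0 π col≤0)))

  ext-nC≡⇒nC∈Y : ∀ {v} → v ∈Y sh → 1ℤ ≤ π v → ext π (nC v) ≡ π v → nC v ∈Y sh
  ext-nC≡⇒nC∈Y v∈ 1≤πv ext≡ with nC∈Y⊎row≤0 v∈
  ... | inj₁ nv∈ = nv∈
  ... | inj₂ row≤0 = ⊥-elim (1≰0 1≤πv (≤-reflexive (trans (sym ext≡) (ext-row≤0 π row≤0))))

module Candidates {sh : List ℕ} (isP : IsPartition sh) (K : Corners sh)
                  {π : Cell → ℤ} (rpp : IsRPP sh π) where
  open Diagram isP
  open Rims isP K
  open Extension isP rpp

  Cand⇒westDrop : ∀ {z} → Cand K π z → ext π (wC z) < π z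
  Cand⇒westDrop (inj₁ (_ , wdrop)) = wdrop
  Cand⇒westDrop (inj₂ (_ , wdrop , _)) = wdrop

  Cand⇒𝓞𝓐 : ∀ {z} → Cand K π z → 𝓞 (content z) ⊎ 𝓐 (content z)
  Cand⇒𝓞𝓐 (inj₁ ((_ , c∈O) , _)) = inj₁ c∈O
  Cand⇒𝓞𝓐 (inj₂ ((_ , c∈A) , _)) = inj₂ c∈A

  -- Climbing the column of z while π stays constant reaches a candidate.
  candidateAbove : ∀ n {z} → row z ≤ + n → z ∈Y sh → 𝓞 (content z) ⊎ 𝓐 (content z) →
                   ext π (wC z) < π z → Σ Cell λ z' → z' ∈Y sh × Cand K π z' × z' ⊴ z
  candidateAbove ℕ.zero fuel z∈ _ _ = ⊥-elim (1≰0 (∈Y⇒1≤row z∈) fuel)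
  candidateAbove (ℕ.suc n) {z} fuel z∈ (inj₁ c∈O) wdrop = z , z∈ , inj₁ ((z∈ , c∈O) , wdrop) , ⊴-refl {z}
  candidateAbove (ℕ.suc n) {z} fuel z∈ (inj₂ c∈A) wdrop with ≤⇒<⊎≡ (ext-nC≤ z∈)
  ... | inj₁ ndrop = z , z∈ , inj₂ ((z∈ , c∈A) , wdrop , ndrop) , ⊴-refl {z}
  ... | inj₂ plateau with candidateAbove n (fuel-pred fuel) nz∈ nz-class nz-wdrop
    where
    nz∈ : nC z ∈Y sh
    nz∈ = ext-nC≡⇒nC∈Y z∈ (<⇒+1≤ (≤-<-trans (0≤ext-wC z∈) wdrop)) plateau
    nz-class : 𝓞 (content (nC z)) ⊎ 𝓐 (content (nC z))
    nz-class = 𝓘𝓐⇒next-𝓞𝓐 N z (inj₂ c∈A)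
    nz-wdrop : ext π (wC (nC z)) < π (nC z)
    nz-wdrop = <-≤-trans (≤-<-trans (ext-nC-wC≤ext-wC z∈) wdrop)
                         (≤-reflexive (trans (sym plateau) (ext-∈Y nz∈)))
  ... | z' , z'∈ , z'-cand , z'⊴nz =
    z' , z'∈ , z'-cand , ⊴-trans {z'} {nC z} {z} z'⊴nz (inj₁ (subst (content z <_) (sym (content-nC z)) (i<i+1 _)))

module _ {sh : List ℕ} {K : Corners sh} {π : Cell → ℤ} where

  QFrom-rest : ∀ {v d ds} → QFrom K π v (d ∷ ds) → QFrom K π (move d v) ds
  QFrom-rest (goN _ _ q) = q
  QFrom-rest (goE₁ _ q) = q
  QFrom-rest (goE₂ _ _ q) = q

  QFrom-plateau : ∀ {v ds} → QFrom K π v (N ∷ ds) → ext π (nC v) ≡ π v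
  QFrom-plateau (goN _ plateau _) = plateau

  QFrom-tail-eC∉ : ∀ {v ds} → QFrom K π v ds → ¬ (eC (tailFrom v ds) ∈Y sh)
  QFrom-tail-eC∉ (stop _ ev∉) = ev∉
  QFrom-tail-eC∉ (goN _ _ q) = QFrom-tail-eC∉ q
  QFrom-tail-eC∉ (goE₁ _ q) = QFrom-tail-eC∉ q
  QFrom-tail-eC∉ (goE₂ _ _ q) = QFrom-tail-eC∉ q

  Suffix-QFrom : ∀ {v ds x dsx} → QFrom K π v ds → Suffix (x , dsx) (v , ds) → QFrom K π x dsx
  Suffix-QFrom q here = q
  Suffix-QFrom q (there suffix) = Suffix-QFrom (QFrom-rest q) suffix

-- The path Q(π,u) of the minimal candidate

module MinimalCandidate {sh : List ℕ} (isP : IsPartition sh) (K : Corners sh)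
                        {π : Cell → ℤ} (rpp : IsRPP sh π)
                        {u : Cell} (u∈ : u ∈Y sh) (u-cand : Cand K π u)
                        (u-min : ∀ v → v ∈Y sh → Cand K π v → u ⊴ v) where
  open Diagram isP
  open Rims isP K
  open Extension isP rpp
  open Candidates isP K rpp

  u⊴westDrop : ∀ {z} → z ∈Y sh → 𝓞 (content z) ⊎ 𝓐 (content z) → ext π (wC z) < π z → u ⊴ z
  u⊴westDrop {z} z∈ z-class wdrop
    with candidateAbove _ (≤+∣∣ (≤-trans (+≤+ ℕ.z≤n) (∈Y⇒1≤row z∈))) z∈ z-class wdrop
  ... | z' , z'∈ , z'-cand , z'⊴z = ⊴-trans {u} {z'} {z} (u-min z' z'∈ z'-cand) z'⊴z

  noWestDropBeyond : ∀ {z} → content u < content z → z ∈Y sh →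
                     𝓞 (content z) ⊎ 𝓐 (content z) → ¬ (ext π (wC z) < π z)
  noWestDropBeyond {z} cu<cz z∈ z-class wdrop =
    <-irrefl refl (<-≤-trans cu<cz (⊴⇒content≥ {u} {z} (u⊴westDrop z∈ z-class wdrop)))

  u-wdrop : ext π (wC u) < π u
  u-wdrop = Cand⇒westDrop u-cand

  1≤πu : 1ℤ ≤ π u
  1≤πu = <⇒+1≤ (≤-<-trans (0≤ext-wC u∈) u-wdrop)

  record QInvariant (v : Cell) : Set where
    field
      ∈λ : v ∈Y sh
      content-u≤ : content u ≤ content v
      value-u≤ : π u ≤ π v
      northwest< : ext π (nC (wC v)) < π v
  open QInvariant public

  QInvariant-u : QInvariant u
  QInvariant-u = record
    { ∈λ = u∈ ; content-u≤ = ≤-refl ; value-u≤ = ≤-refl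
    ; northwest< = ≤-<-trans (ext-nC-wC≤ext-wC u∈) u-wdrop }

  𝓘𝓐-plateau-east : ∀ {v} → QInvariant v → 𝓘 (content v) ⊎ 𝓐 (content v) → π (eC v) ≡ π v
  𝓘𝓐-plateau-east {v} inv c∈IA = sym (≤∧≮⇒≡ (proj₁ (proj₂ (rpp v (∈λ inv))) ev∈) no-rise)
    where
    ev∈ : eC v ∈Y sh
    ev∈ = 𝓘⊎𝓐⇒eC∈Y (∈λ inv) c∈IA
    no-rise : ¬ (π v < π (eC v))
    no-rise πv<πev = noWestDropBeyond
      (subst (content u <_) (sym (content-eC v)) (≤⇒<+1 (content-u≤ inv)))
      ev∈ (𝓘𝓐⇒next-𝓞𝓐 E v c∈IA)
      (subst (_< π (eC v)) (sym (trans (cong (ext π) (wC-eC v)) (ext-∈Y (∈λ inv)))) πv<πev)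

  𝓘𝓐-drop-north : ∀ {v} → QInvariant v → 𝓘 (content v) ⊎ 𝓐 (content v) → ext π (nC v) < π v
  𝓘𝓐-drop-north {v} inv c∈IA = ≤∧≢⇒< (ext-nC≤ (∈λ inv)) no-plateau
    where
    no-plateau : ext π (nC v) ≢ π v
    no-plateau plateau = noWestDropBeyond
      (subst (content u <_) (sym (content-nC v)) (≤⇒<+1 (content-u≤ inv)))
      nv∈ (𝓘𝓐⇒next-𝓞𝓐 N v c∈IA)
      (<-≤-trans (northwest< inv) (≤-reflexive (trans (sym plateau) (ext-∈Y nv∈))))
      where
      nv∈ : nC v ∈Y sh
      nv∈ = ext-nC≡⇒nC∈Y (∈λ inv) (≤-trans 1≤πu (value-u≤ inv)) plateau

  QInvariant-north : ∀ {v} → QInvariant v → ext π (nC v) ≡ π v → QInvariant (nC v)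
  QInvariant-north {v} inv plateau = record
    { ∈λ = nv∈
    ; content-u≤ = ≤-trans (content-u≤ inv) (<⇒≤ (content<content-move N v))
    ; value-u≤ = ≤-trans (value-u≤ inv) (≤-reflexive πv≡πnv)
    ; northwest< = <-≤-trans (≤-<-trans (ext-nC-wC≤ext-wC nv∈) (northwest< inv)) (≤-reflexive πv≡πnv) }
    where
    nv∈ : nC v ∈Y sh
    nv∈ = ext-nC≡⇒nC∈Y (∈λ inv) (≤-trans 1≤πu (value-u≤ inv)) plateau
    πv≡πnv : π v ≡ π (nC v)
    πv≡πnv = trans (sym plateau) (ext-∈Y nv∈)

  QInvariant-east : ∀ {v} → QInvariant v → ext π (nC v) < π v → eC v ∈Y sh → QInvariant (eC v)
  QInvariant-east {v} inv ndrop ev∈ = record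
    { ∈λ = ev∈
    ; content-u≤ = ≤-trans (content-u≤ inv) (<⇒≤ (content<content-move E v))
    ; value-u≤ = ≤-trans (value-u≤ inv) πv≤πev
    ; northwest< = <-≤-trans (subst (λ z → ext π (nC z) < π v) (sym (wC-eC v)) ndrop) πv≤πev }
    where
    πv≤πev : π v ≤ π (eC v)
    πv≤πev = proj₁ (proj₂ (rpp v (∈λ inv))) ev∈

  QInvariant-east-𝓘𝓐 : ∀ {v} → QInvariant v → 𝓘 (content v) ⊎ 𝓐 (content v) → QInvariant (eC v)
  QInvariant-east-𝓘𝓐 inv c∈IA =
    QInvariant-east inv (𝓘𝓐-drop-north inv c∈IA) (𝓘⊎𝓐⇒eC∈Y (∈λ inv) c∈IA)

  QInvariant-step : ∀ {v d ds} → QInvariant v → QFrom K π v (d ∷ ds) → QInvariant (move d v)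
  QInvariant-step inv (goN _ plateau _) = QInvariant-north inv plateau
  QInvariant-step inv (goE₁ r _) = QInvariant-east-𝓘𝓐 inv (𝓘𝓐-class r)
  QInvariant-step inv (goE₂ ndrop ev∈ _) = QInvariant-east inv ndrop ev∈

  Suffix-QInvariant : ∀ {v ds x dsx} → QInvariant v → QFrom K π v ds →
                      Suffix (x , dsx) (v , ds) → QInvariant x
  Suffix-QInvariant inv q here = inv
  Suffix-QInvariant inv q (there suffix) = Suffix-QInvariant (QInvariant-step inv q) (QFrom-rest q) suffix

  QFrom-north : ∀ {x dsx} → QInvariant x → QFrom K π x dsx →
                (ext π (nC x) < π x) ⊎ (nC x ∈ cellsFrom x dsx)
  QFrom-north _ (stop ndrop _) = inj₁ ndrop
  QFrom-north _ (goN {ds = ds} _ _ _) = inj₂ (there (headFrom∈cellsFrom _ ds))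
  QFrom-north inv (goE₁ r _) = inj₁ (𝓘𝓐-drop-north inv (𝓘𝓐-class r))
  QFrom-north _ (goE₂ ndrop _ _) = inj₁ ndrop

  QFrom-east-𝓘𝓐 : ∀ {x dsx} → QInvariant x → QFrom K π x dsx → 𝓘 (content x) ⊎ 𝓐 (content x) →
                  (eC x ∈ cellsFrom x dsx) × (π (eC x) ≡ π x)
  QFrom-east-𝓘𝓐 inv (stop _ ex∉) c∈IA = ⊥-elim (ex∉ (𝓘⊎𝓐⇒eC∈Y (∈λ inv) c∈IA))
  QFrom-east-𝓘𝓐 _ (goN r _ _) c∈IA = ⊥-elim (disjoint-𝓞𝓑-𝓘𝓐 (𝓞𝓑-class r) c∈IA)
  QFrom-east-𝓘𝓐 inv (goE₁ {ds = ds} _ _) c∈IA =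
    there (headFrom∈cellsFrom _ ds) , 𝓘𝓐-plateau-east inv c∈IA
  QFrom-east-𝓘𝓐 inv (goE₂ {ds = ds} _ _ _) c∈IA =
    there (headFrom∈cellsFrom _ ds) , 𝓘𝓐-plateau-east inv c∈IA

  QFrom-north-plateau : ∀ {x dsx} → QFrom K π x dsx → nC x ∈Y sh →
                        nC x ∈ cellsFrom x dsx → π (nC x) ≡ π x
  QFrom-north-plateau {x} {dsx} q nx∈ nx∈Q with nC∈cellsFrom⇒N x dsx nx∈Q
  ... | _ , refl = trans (sym (ext-∈Y nx∈)) (QFrom-plateau q)

  QFrom-east-exit : ∀ {x dsx} → QFrom K π x dsx → ¬ (eC x ∈ cellsFrom x dsx) → eC x ∈Y sh →
                    𝓞 (content x) ⊎ 𝓑 (content x)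
  QFrom-east-exit (goN r _ _) _ _ = 𝓞𝓑-class r
  QFrom-east-exit (goE₁ {ds = ds} _ _) ex∉Q _ = ⊥-elim (ex∉Q (there (headFrom∈cellsFrom _ ds)))
  QFrom-east-exit (goE₂ {ds = ds} _ _ _) ex∉Q _ = ⊥-elim (ex∉Q (there (headFrom∈cellsFrom _ ds)))
  QFrom-east-exit (stop _ ex∉) _ ex∈ = ⊥-elim (ex∉ ex∈)

  -- A cell entered from the south lies on a plateau, where the invariant
  -- gives the drop to the west.
  QFrom-west : ∀ {v ds} → QInvariant v → QFrom K π v ds → ∀ {x} → x ∈ cellsFrom v ds →
               (x ≡ v) ⊎ (ext π (wC x) < π x) ⊎ (wC x ∈ cellsFrom v ds)
  QFrom-west {ds = []} _ _ (here refl) = inj₁ refl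
  QFrom-west {ds = _ ∷ _} _ _ (here refl) = inj₁ refl
  QFrom-west {v} {d ∷ ds} inv q (there x∈) with QFrom-west (QInvariant-step inv q) (QFrom-rest q) x∈
  ... | inj₁ refl = inj₂ (entered d q)
    where
    entered : ∀ d → QFrom K π v (d ∷ ds) →
              (ext π (wC (move d v)) < π (move d v)) ⊎ (wC (move d v) ∈ cellsFrom v (d ∷ ds))
    entered N q = inj₁ (<-≤-trans (northwest< inv) (≤-reflexive (trans (sym (QFrom-plateau q)) (ext-∈Y nv∈))))
      where
      nv∈ : nC v ∈Y sh
      nv∈ = ∈λ (QInvariant-step inv q)
    entered E _ = inj₂ (here (wC-eC v))
  ... | inj₂ (inj₁ wdrop) = inj₂ (inj₁ wdrop)
  ... | inj₂ (inj₂ wx∈) = inj₂ (inj₂ (there wx∈))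

  QFrom-exists : ∀ n {v} → QInvariant v → + part sh 0 - content v ≤ + n → Σ (List Dir) (QFrom K π v)
  QFrom-exists ℕ.zero inv fuel = ⊥-elim (fuel-exhausted fuel (content<part₀ (∈λ inv)) ≤-refl)
  QFrom-exists (ℕ.suc n) {v} inv fuel = byClass (classify (interleave K) (content v))
    where
    v∈ : v ∈Y sh
    v∈ = ∈λ inv
    continue : ∀ d → QInvariant (move d v) → Σ (List Dir) (QFrom K π (move d v))
    continue d inv' = QFrom-exists n inv' (fuel-pred-sub {+ part sh 0} {content v} (content-move d v) fuel)
    fromOB : inO K v ⊎ inB K v → Σ (List Dir) (QFrom K π v)
    fromOB r with ≤⇒<⊎≡ (ext-nC≤ v∈)
    ... | inj₂ plateau = Σ-map (N ∷_) (goN r plateau) (continue N (QInvariant-north inv plateau))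
    ... | inj₁ ndrop with eC v ∈Y?
    ...   | no ev∉ = [] , stop ndrop ev∉
    ...   | yes ev∈ = Σ-map (E ∷_) (goE₂ ndrop ev∈) (continue E (QInvariant-east inv ndrop ev∈))
    fromIA : inI K v ⊎ inA K v → Σ (List Dir) (QFrom K π v)
    fromIA r = Σ-map (E ∷_) (goE₁ r) (continue E (QInvariant-east-𝓘𝓐 inv (𝓘𝓐-class r)))
    byClass : 𝓞 (content v) ⊎ 𝓘 (content v) ⊎ 𝓐 (content v) ⊎ 𝓑 (content v) → Σ (List Dir) (QFrom K π v)
    byClass (inj₁ c∈O) = fromOB (inj₁ (v∈ , c∈O))
    byClass (inj₂ (inj₁ c∈I)) = fromIA (inj₁ (v∈ , c∈I))
    byClass (inj₂ (inj₂ (inj₁ c∈A))) = fromIA (inj₂ (v∈ , c∈A))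
    byClass (inj₂ (inj₂ (inj₂ c∈B))) = fromOB (inj₂ (v∈ , c∈B))

  Q-exists : Σ (List Dir) (QFrom K π u)
  Q-exists = QFrom-exists _ QInvariant-u (≤+∣∣ (i≤j⇒0≤j-i (<⇒≤ (content<part₀ u∈))))

  module Removal {ds : List Dir} (q : QFrom K π u ds) where

    Q : NEPath
    Q = u , ds

    σ : Cell → ℤ
    σ = π ⊖ Q

    Q-invariant : ∀ {x} → x ∈P Q → QInvariant x
    Q-invariant x∈ = Suffix-QInvariant QInvariant-u q (proj₂ (∈⇒Suffix x∈))

    σ-∈ : ∀ {x} → x ∈P Q → σ x ≡ π x - 1ℤ
    σ-∈ x∈ = cong (π _ -_) (indicator-∈ Q x∈)

    σ-∉ : ∀ {x} → ¬ (x ∈P Q) → σ x ≡ π x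
    σ-∉ {x} x∉ = trans (cong (π x -_) (indicator-∉ Q x∉)) (+-identityʳ (π x))

    Q-north : ∀ {x} → x ∈P Q → ¬ (nC x ∈P Q) → ext π (nC x) < π x
    Q-north x∈ nx∉ with ∈⇒Suffix x∈
    ... | _ , suffix with QFrom-north (Q-invariant x∈) (Suffix-QFrom q suffix)
    ...   | inj₁ ndrop = ndrop
    ...   | inj₂ nx∈ = ⊥-elim (nx∉ (Suffix-⊆ suffix nx∈))

    Q-west : ∀ {x} → x ∈P Q → ¬ (wC x ∈P Q) → ext π (wC x) < π x
    Q-west x∈ wx∉ with QFrom-west QInvariant-u q x∈
    ... | inj₁ refl = u-wdrop
    ... | inj₂ (inj₁ wdrop) = wdrop
    ... | inj₂ (inj₂ wx∈) = ⊥-elim (wx∉ wx∈)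

    Q-east-exit : ∀ {x} → x ∈P Q → ¬ (eC x ∈P Q) → eC x ∈Y sh →
                  𝓘 (content (eC x)) ⊎ 𝓑 (content (eC x))
    Q-east-exit {x} x∈ ex∉Q ex∈ with ∈⇒Suffix x∈
    ... | _ , suffix = subst (λ c → 𝓘 c ⊎ 𝓑 c) (sym (content-eC x)) (swap (O⊎B⇒suc∈B⊎I (interleave K)
          (QFrom-east-exit (Suffix-QFrom q suffix) (λ ex∈suffix → ex∉Q (Suffix-⊆ suffix ex∈suffix)) ex∈)))

    σ-mono : ∀ {y z} → π y ≤ π z → (z ∈P Q → ¬ (y ∈P Q) → π y < π z) → σ y ≤ σ z
    σ-mono {y} {z} πy≤πz strict = byMembership (y ∈? cells Q) (z ∈? cells Q)
      where
      byMembership : Dec (y ∈P Q) → Dec (z ∈P Q) → σ y ≤ σ z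
      byMembership (yes y∈) (yes z∈) =
        subst₂ _≤_ (sym (σ-∈ y∈)) (sym (σ-∈ z∈)) (+-monoˡ-≤ (ℤ.- 1ℤ) πy≤πz)
      byMembership (yes y∈) (no z∉) =
        subst₂ _≤_ (sym (σ-∈ y∈)) (sym (σ-∉ z∉)) (≤-trans (<⇒≤ (i-1<i _)) πy≤πz)
      byMembership (no y∉) (no z∉) = subst₂ _≤_ (sym (σ-∉ y∉)) (sym (σ-∉ z∉)) πy≤πz
      byMembership (no y∉) (yes z∈) = subst₂ _≤_ (sym (σ-∉ y∉)) (sym (σ-∈ z∈)) (<⇒≤-1 (strict z∈ y∉))

    σ-IsRPP : IsRPP sh σ
    σ-IsRPP y y∈ = nonneg , eastward , southward
      where
      nonneg : 0ℤ ≤ σ y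
      nonneg = byMembership (y ∈? cells Q)
        where
        byMembership : Dec (y ∈P Q) → 0ℤ ≤ σ y
        byMembership (yes y∈Q) = subst (0ℤ ≤_) (sym (σ-∈ y∈Q))
          (<⇒≤-1 (+1≤⇒< (≤-trans 1≤πu (value-u≤ (Q-invariant y∈Q)))))
        byMembership (no y∉Q) = subst (0ℤ ≤_) (sym (σ-∉ y∉Q)) (proj₁ (rpp y y∈))
      eastward : eC y ∈Y sh → σ y ≤ σ (eC y)
      eastward ey∈ = σ-mono (proj₁ (proj₂ (rpp y y∈)) ey∈) λ ey∈Q y∉Q →
        subst (_< π (eC y)) (trans (cong (ext π) (wC-eC y)) (ext-∈Y y∈))
              (Q-west ey∈Q (λ wey∈Q → y∉Q (subst (_∈P Q) (wC-eC y) wey∈Q)))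
      southward : sC y ∈Y sh → σ y ≤ σ (sC y)
      southward sy∈ = σ-mono (proj₂ (proj₂ (rpp y y∈)) sy∈) λ sy∈Q y∉Q →
        subst (_< π (sC y)) (trans (cong (ext π) (nC-sC y)) (ext-∈Y y∈))
              (Q-north sy∈Q (λ nsy∈Q → y∉Q (subst (_∈P Q) (nC-sC y) nsy∈Q)))

    σ⊕Q≡π : ∀ y → (σ ⊕ Q) y ≡ π y
    σ⊕Q≡π y = lemma (π y) (indicator Q y)
      where
      lemma : ∀ a b → a - b + b ≡ a
      lemma = solve-∀

    Q-compatible : Compatible K σ Q
    Q-compatible = east , north
      where
      east : ∀ x → x ∈P Q → inI K x ⊎ inA K x → (eC x ∈P Q) × (σ (eC x) ≡ σ x)
      east x x∈ r with ∈⇒Suffix x∈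
      ... | _ , suffix with QFrom-east-𝓘𝓐 (Q-invariant x∈) (Suffix-QFrom q suffix) (𝓘𝓐-class r)
      ...   | ex∈ , πex≡πx = ex∈Q , trans (σ-∈ ex∈Q) (trans (cong (_- 1ℤ) πex≡πx) (sym (σ-∈ x∈)))
        where
        ex∈Q : eC x ∈P Q
        ex∈Q = Suffix-⊆ suffix ex∈
      north : ∀ x → x ∈P Q → nC x ∈P Q → σ (nC x) ≡ σ x
      north x x∈ nx∈ with ∈⇒Suffix x∈
      ... | _ , suffix = trans (σ-∈ nx∈) (trans (cong (_- 1ℤ) πnx≡πx) (sym (σ-∈ x∈)))
        where
        πnx≡πx : π (nC x) ≡ π x
        πnx≡πx = QFrom-north-plateau (Suffix-QFrom q suffix) (∈λ (Q-invariant nx∈))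
          (Suffix-complete suffix nx∈ (<⇒≤ (content<content-move N x)))

    Q-inserts : ∀ h → tailP h ≡ tailP Q → lenP h ≡ length ds → Inserts K h σ π
    Q-inserts h tail≡ len≡ = Q , All.tabulate (λ x∈ → ∈λ (Q-invariant x∈)) , Q-compatible ,
      sym tail≡ , sym len≡ , IsRPP-cong {sh} (λ y _ → σ⊕Q≡π y) rpp , (λ y _ → sym (σ⊕Q≡π y))

    tail-Rim : Rim (tailP Q)
    tail-Rim = t∈ , eC∉⇒eC-sC∉ t∈ (QFrom-tail-eC∉ q)
      where
      t∈ : tailP Q ∈Y sh
      t∈ = ∈λ (Q-invariant (tailFrom∈cellsFrom u ds))

    rimHookOfQ : Σ NEPath λ h → IsRimHook sh h × (tailP h ≡ tailP Q) × (lenP h ≡ length ds) ×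
                          (content (headP h) ≡ content u)
    rimHookOfQ with rimPathEndingAt (length ds) tail-Rim u∈ (content-headFrom u ds)
    ... | (h₀ , hs) , tail≡ , len≡ , all-rim = (h₀ , hs) , isRimHook , tail≡ , len≡ , head≡
      where
      head≡ : content h₀ ≡ content u
      head≡ = begin
        content h₀                                 ≡⟨ content-headFrom h₀ hs ⟩
        content (tailFrom h₀ hs) - + length hs     ≡⟨ cong₂ (λ t l → content t - + l) tail≡ len≡ ⟩
        content (tailFrom u ds) - + length ds      ≡⟨ sym (content-headFrom u ds) ⟩
        content u                                  ∎
        where open ≡-Reasoning
      isRimHook : IsRimHook sh (h₀ , hs)
      isRimHook = All.map proj₁ all-rim ,
        Rim-𝓞⊎𝓐⇒sC∉ (All.lookup all-rim (headFrom∈cellsFrom h₀ hs))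
                      (subst (λ c → 𝓞 c ⊎ 𝓐 c) (sym head≡) (Cand⇒𝓞𝓐 u-cand)) ,
        subst (λ t → ¬ (eC t ∈Y sh)) (sym tail≡) (QFrom-tail-eC∉ q) ,
        (λ _ x∈ → proj₂ (All.lookup all-rim x∈))

    hQ : NEPath
    hQ = proj₁ rimHookOfQ

    hQ-IsRimHook : IsRimHook sh hQ
    hQ-IsRimHook = proj₁ (proj₂ rimHookOfQ)

    hQ-tail : tailP hQ ≡ tailP Q
    hQ-tail = proj₁ (proj₂ (proj₂ rimHookOfQ))

    hQ-length : lenP hQ ≡ length ds
    hQ-length = proj₁ (proj₂ (proj₂ (proj₂ rimHookOfQ)))

    hQ-head : content (headP hQ) ≡ content u
    hQ-head = proj₂ (proj₂ (proj₂ (proj₂ rimHookOfQ)))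

    module NextInsertion {σ' : Cell → ℤ} (σ'-rpp : IsRPP sh σ') {a : Cell} {es : List Dir}
                         (P₂-InY : InY sh (a , es))
                         (P₂-tail : ¬ (eC (tailFrom a es) ∈Y sh))
                         (σ≡σ'⊕P₂ : ∀ z → z ∈Y sh → σ z ≡ (σ' ⊕ (a , es)) z) where

      P₂ : NEPath
      P₂ = a , es

      a∈ : a ∈Y sh
      a∈ = All.lookup P₂-InY (headFrom∈cellsFrom a es)

      σ'-value : ∀ {z i j} → z ∈Y sh → indicator Q z ≡ i → indicator P₂ z ≡ j → σ' z ≡ π z - i - j
      σ'-value {z} z∈ refl refl =
        trans (sym (lemma (σ' z) (indicator P₂ z))) (cong (_- indicator P₂ z) (sym (σ≡σ'⊕P₂ z z∈)))
        where
        lemma : ∀ s i → s + i - i ≡ s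
        lemma = solve-∀

      -- σ' would drop from nC x to x.
      north-conflict : ∀ {x} → x ∈P Q → nC x ∈P Q → π (nC x) ≡ π x → x ∈P P₂ → ¬ (nC x ∈P P₂) → ⊥
      north-conflict {x} x∈Q nx∈Q πnx≡πx x∈P₂ nx∉P₂ =
        <-irrefl refl (sub₂-≤⇒< {π x} {π x} le (≤-refl {1ℤ}) 0<1)
        where
        x∈ : x ∈Y sh
        x∈ = ∈λ (Q-invariant x∈Q)
        nx∈ : nC x ∈Y sh
        nx∈ = ∈λ (Q-invariant nx∈Q)
        le : π x - 1ℤ - 0ℤ ≤ π x - 1ℤ - 1ℤ
        le = subst₂ _≤_
          (trans (σ'-value nx∈ (indicator-∈ Q nx∈Q) (indicator-∉ P₂ nx∉P₂))
                 (cong (λ p → p - 1ℤ - 0ℤ) πnx≡πx))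
          (trans (cong σ' (sC-nC x)) (σ'-value x∈ (indicator-∈ Q x∈Q) (indicator-∈ P₂ x∈P₂)))
          (proj₂ (proj₂ (σ'-rpp (nC x) nx∈)) (subst (_∈Y sh) (sym (sC-nC x)) x∈))

      P₂-follows-north : ∀ {x dsx esx} → Suffix (x , N ∷ dsx) Q → Suffix (x , esx) P₂ →
                         Σ (List Dir) λ es' → esx ≡ N ∷ es'
      P₂-follows-north {x} {dsx} {esx} sQ sP with nC x ∈? cells P₂
      ... | yes nx∈P₂ = nC∈cellsFrom⇒N x esx (Suffix-complete sP nx∈P₂ (<⇒≤ (content<content-move N x)))
      ... | no nx∉P₂ =
        ⊥-elim (north-conflict x∈Q nx∈Q πnx≡πx (Suffix-⊆ sP (headFrom∈cellsFrom x esx)) nx∉P₂)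
        where
        x∈Q : x ∈P Q
        x∈Q = Suffix-⊆ sQ (here refl)
        nx∈Q : nC x ∈P Q
        nx∈Q = Suffix-⊆ sQ (there (headFrom∈cellsFrom (nC x) dsx))
        πnx≡πx : π (nC x) ≡ π x
        πnx≡πx = trans (sym (ext-∈Y (∈λ (Q-invariant nx∈Q)))) (QFrom-plateau (Suffix-QFrom q sQ))

      -- On each diagonal P₂ stays weakly north-west of Q, so it ends no earlier.
      tie : ∀ {x dsx y esy} → Suffix (x , dsx) Q → Suffix (y , esy) P₂ →
            content x ≡ content y → row y ≤ row x → length dsx ℕ.≤ length esy
      tie {dsx = []} _ _ _ _ = ℕ.z≤n
      tie {x} {d ∷ dsx} {y} {esy} sQ sP cx≡cy ry≤rx with ≤⇒<⊎≡ ry≤rx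
      ... | inj₁ ry<rx = behind esy sP
        where
        x∈ : x ∈Y sh
        x∈ = ∈λ (Q-invariant (Suffix-⊆ sQ (here refl)))
        behind : ∀ esy → Suffix (y , esy) P₂ → ℕ.suc (length dsx) ℕ.≤ length esy
        behind [] sP = ⊥-elim (P₂-tail (subst (λ t → eC t ∈Y sh) (Suffix-tail sP)
          (diagonal-eC∈Y x∈ (All.lookup P₂-InY (Suffix-⊆ sP (here refl))) (sym cx≡cy) ry<rx)))
        behind (d' ∷ esy) sP = ℕ.s≤s (tie (Suffix-next sQ) (Suffix-next sP)
          (trans (content-move d x) (trans (cong (_+ 1ℤ) cx≡cy) (sym (content-move d' y))))
          (≤-trans (row-move≤ d' y) (≤-trans (<⇒≤-1 ry<rx) (row-1≤row-move d x))))
      ... | inj₂ ry≡rx with row-content-injective {y} {x} ry≡rx (sym cx≡cy)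
      ...   | refl = same d esy sQ sP
        where
        same : ∀ d esy → Suffix (x , d ∷ dsx) Q → Suffix (x , esy) P₂ → ℕ.suc (length dsx) ℕ.≤ length esy
        same N esy sQ sP with P₂-follows-north sQ sP
        ... | _ , refl = ℕ.s≤s (tie (Suffix-next sQ) (Suffix-next sP) refl ≤-refl)
        same E [] sQ sP = ⊥-elim (P₂-tail (subst (λ t → eC t ∈Y sh) (Suffix-tail sP)
          (∈λ (Q-invariant (Suffix-⊆ sQ (there (headFrom∈cellsFrom (eC x) dsx)))))))
        same E (d' ∷ esy) sQ sP = ℕ.s≤s (tie (Suffix-next sQ) (Suffix-next sP)
          (trans (content-eC x) (sym (content-move d' x))) (row-move≤ d' x))

      head-westDrop : 𝓞 (content a) ⊎ 𝓐 (content a) → ext π (wC a) < π a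
      head-westDrop a-class with wC∈Y⊎col≤0 a∈
      ... | inj₂ col≤0 = subst (_< π a) (sym (ext-col≤0 π col≤0))
        (sub₂-≤⇒< {0ℤ} {π a} {0ℤ} {indicator Q a} {0ℤ} {1ℤ}
          (subst (0ℤ ≤_) (σ'-value a∈ refl (indicator-∈ P₂ (headFrom∈cellsFrom a es))) (proj₁ (σ'-rpp a a∈)))
          (0≤indicator Q a) 0<1)
      ... | inj₁ wa∈ = subst (_< π a) (sym (ext-∈Y wa∈)) (sub₂-≤⇒< le (indicator-mono Q wa→a) 0<1)
        where
        le : π (wC a) - indicator Q (wC a) - 0ℤ ≤ π a - indicator Q a - 1ℤ
        le = subst₂ _≤_ (σ'-value wa∈ refl (indicator-∉ P₂ (wC∉cellsFrom a es)))
                        (trans (cong σ' (eC-wC a)) (σ'-value a∈ refl (indicator-∈ P₂ (headFrom∈cellsFrom a es))))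
                        (proj₁ (proj₂ (σ'-rpp (wC a) wa∈)) (subst (_∈Y sh) (sym (eC-wC a)) a∈))
        wa→a : wC a ∈P Q → a ∈P Q
        wa→a wa∈Q with a ∈? cells Q
        ... | yes a∈Q = a∈Q
        ... | no a∉Q = ⊥-elim (disjoint-𝓞𝓐-𝓘𝓑 a-class (subst (λ c → 𝓘 c ⊎ 𝓑 c) (cong content (eC-wC a))
                (Q-east-exit wa∈Q (λ ewa∈Q → a∉Q (subst (_∈P Q) (eC-wC a) ewa∈Q))
                                  (subst (_∈Y sh) (sym (eC-wC a)) a∈))))

    hook-≤ : ∀ {h₂ σ'} → IsRimHook sh h₂ → Inserts K h₂ σ' σ → IsRPP sh σ' → hQ ≤h h₂
    hook-≤ {b , bs} {σ'} (h₂-InY , sb∉ , eh₂∉ , h₂-rim)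
           ((a , es) , P₂-InY , _ , tail≡ , len≡ , _ , σ≡) σ'-rpp =
      byOrder (u⊴westDrop a∈ a-class (head-westDrop a-class))
      where
      open NextInsertion σ'-rpp P₂-InY (subst (λ t → ¬ (eC t ∈Y sh)) (sym tail≡) eh₂∉) σ≡
      ca≡cb : content a ≡ content b
      ca≡cb = begin
        content a                                ≡⟨ content-headFrom a es ⟩
        content (tailFrom a es) - + length es    ≡⟨ cong₂ (λ t l → content t - + l) tail≡ len≡ ⟩
        content (tailFrom b bs) - + length bs    ≡⟨ sym (content-headFrom b bs) ⟩
        content b                                ∎
        where open ≡-Reasoning
      a-class : 𝓞 (content a) ⊎ 𝓐 (content a)
      a-class = subst (λ c → 𝓞 c ⊎ 𝓐 c) (sym ca≡cb)
        (Rim-sC∉⇒𝓞⊎𝓐 (All.lookup h₂-InY b∈h₂ , h₂-rim b b∈h₂) sb∉)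
        where
        b∈h₂ : b ∈P (b , bs)
        b∈h₂ = headFrom∈cellsFrom b bs
      byOrder : u ⊴ a → hQ ≤h (b , bs)
      byOrder (inj₁ ca<cu) = inj₁ (subst₂ _<_ ca≡cb (sym hQ-head) ca<cu)
      byOrder (inj₂ (cu≡ca , ra≤ru)) = inj₂ (trans hQ-head (trans cu≡ca ca≡cb) , tails)
        where
        tails : content (tailP hQ) ≤ content (tailFrom b bs)
        tails = begin
          content (tailP hQ)        ≡⟨ cong content hQ-tail ⟩
          content (tailFrom u ds)   ≡⟨ content-tailFrom u ds ⟩
          content u + + length ds   ≤⟨ +-mono-≤ (≤-reflexive cu≡ca) (+≤+ (tie here here cu≡ca ra≤ru)) ⟩
          content a + + length es   ≡⟨ sym (content-tailFrom a es) ⟩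
          content (tailFrom a es)   ≡⟨ cong content tail≡ ⟩
          content (tailFrom b bs)   ∎
          where open ≤-Reasoning

    LexFact-cons : ∀ hs → LexFact K σ hs → LexFact K π (hQ ∷ hs)
    LexFact-cons [] (_ , _ , ev) =
      hQ-IsRimHook ∷ [] , Linked.[-] , cons ev (Q-inserts hQ hQ-tail hQ-length)
    LexFact-cons (h₂ ∷ hs) (h₂-rim ∷ rims , linked , ev@(cons ev' h₂-inserts)) =
      hQ-IsRimHook ∷ h₂-rim ∷ rims , hook-≤ h₂-rim h₂-inserts (Eval⇒IsRPP ev') Linked.∷ linked ,
      cons ev (Q-inserts hQ hQ-tail hQ-length)

theorem5 : (sh : List ℕ) → IsPartition sh → (K : Corners sh)
    → (π : Cell → ℤ) → IsRPP sh π
    → (u : Cell) → u ∈Y sh → Cand K π u → (∀ v → v ∈Y sh → Cand K π v → u ⊴ v)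
    → Σ (List Dir) (QFrom K π u)
      × (∀ ds → QFrom K π u ds
          → IsRPP sh (π ⊖ (u , ds))
            × Σ NEPath (λ h → IsRimHook sh h × (tailP h ≡ tailP (u , ds)) × (lenP h ≡ length ds)
                × (∀ hs → LexFact K (π ⊖ (u , ds)) hs → LexFact K π (h ∷ hs))))
theorem5 sh isP K π rpp u u∈ u-cand u-min =
  Q-exists , λ ds q → let open Removal q in
    σ-IsRPP , hQ , hQ-IsRimHook , hQ-tail , hQ-length , LexFact-cons
  where open MinimalCandidate isP K rpp u∈ u-cand u-min
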